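{- For every $k\ge1$ and every $\Sigma^1_1(\mathrm{FOC}^k)$-definable generalized atom $A_Q$, for every sentence of $\mathrm{FO}^k(A_Q)$ there exists an equivalent sentence of $\Sigma^1_1(\mathrm{FOC}^k)$ (i.e., true in exactly the same models).
   Context: Team semantics (lax): structures have nonempty domains and relational vocabularies; an assignment is $s:D\to A$, $D$ a finite set of variables; a team $X$ is a set of assignments with common domain and codomain $A$; $\mathrm{rel}(X,(y_1,\dots,y_m))=\{(s(y_1),\dots,s(y_m)):s\in X\}$. Formulas in negation normal form (literals $R(\bar x),\neg R(\bar x),x_1=x_2,\neg x_1=x_2$, $\wedge,\vee,\exists,\forall$) plus generalized atoms; semantics: literal holds in $X$ iff all $s\in X$ satisfy it; $\wedge$ componentwise; $\psi\vee\vartheta$ holds in $X$ iff $X=Y\cup Z$, $Y\models\psi$, $Z\models\vartheta$; $\exists x\psi$ holds in $X$ iff $\psi$ holds in $\{s[a/x]:s\in X,a\in F(s)\}$ for some $F:X\to\mathcal P(A)\setminus\{\emptyset\}$; $\forall x\psi$ holds in $X$ iff $\psi$ holds in $\{s[a/x]:s\in X,a\in A\}$. A sentence is true in $\mathfrak A$ iff satisfied by $\{\emptyset\}$. A generalized quantifier of type $(i_1,\dots,i_n)$ is an isomorphism-closed class $Q$ of structures $(A,B_1,\dots,B_n)$, $B_j\subseteq A^{i_j}$; the atom $A_Q(\bar y_1,\dots,\bar y_n)$ holds in $X$ iff $(A,\mathrm{rel}(X,\bar y_1),\dots,\mathrm{rel}(X,\bar y_n))\in Q$. $\mathrm{FO}^k(A_Q)$: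 first-order logic with $A_Q$-atoms using only variables $x_1,\dots,x_k$. $\mathrm{FOC}$: first-order logic with counting quantifiers $\exists^{\ge i}$; $\mathrm{FOC}^k$: its $k$-variable fragment; $\Sigma^1_1(\mathrm{FOC}^k)$: formulas $\exists X_1\dots\exists X_m\chi$, $\chi\in\mathrm{FOC}^k$. $A_Q$ (with all $i_j\le k$) is $\Sigma^1_1(\mathrm{FOC}^k)$-definable if there is a $\Sigma^1_1(\mathrm{FOC}^k)$-sentence $\varphi(R_1,\dots,R_n)$ ($R_j$ of arity $i_j$) with $\mathfrak A\models_X A_Q(\bar x_1,\dots,\bar x_n)$ iff $(\mathfrak A,R_j:=\mathrm{rel}(X,\bar x_j))_j\models\varphi$, for all $\mathfrak A$ and teams $X$ with codomain $A$ whose domain contains the relevant variables. -}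

module Defs where

open import Level using (0ℓ; Level) renaming (suc to lsuc)
open import Data.Nat using (ℕ; _≤_)
open import Data.Fin using (Fin)
open import Data.Fin.Subset using (Subset; _∈_; ⊥; inside)
open import Data.Vec using (Vec; map; lookup; _[_]≔_; replicate)
open import Data.Maybe using (Maybe; just; nothing; Is-just)
open import Data.List using (List; length)
import Data.List as L
open import Data.Sum using (_⊎_; inj₁; inj₂; [_,_])
open import Data.Product using (Σ; ∃; ∃₂; _×_; _,_)
open import Relation.Nullary using (¬_)
open import Relation.Binary.PropositionalEquality using (_≡_; _≢_)
open import Function.Bundles using (_⤖_; Bijection)
open import Function.Definitions using (Injective)

record Vocab : Set₁ where
  field
    Sym : Set
    ar  : Sym → ℕ
open Vocab public

_⊕_ : Vocab → Vocab → Vocab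
τ ⊕ σ = record { Sym = Sym τ ⊎ Sym σ ; ar = [ ar τ , ar σ ] }

listVoc : List ℕ → Vocab
listVoc ts = record { Sym = Fin (length ts) ; ar = L.lookup ts }

-- structures: nonempty domain, relations as predicates on tuples
record Struct (τ : Vocab) : Set₁ where
  field
    U    : Set
    elem : U
    rel  : (R : Sym τ) → Vec U (ar τ R) → Set
open Struct public

expand : {τ σ : Vocab} (𝔄 : Struct τ) →
         ((R : Sym σ) → Vec (U 𝔄) (ar σ R) → Set) → Struct (τ ⊕ σ)
expand 𝔄 I = record { U = U 𝔄 ; elem = elem 𝔄 ; rel = λ { (inj₁ R) → rel 𝔄 R ; (inj₂ R) → I R } }

-- FOC^k : first-order logic with counting quantifiers, variables x_1..x_k (= Fin k)

data FOC (τ : Vocab) (k : ℕ) : Set where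
  relᶠ   : (R : Sym τ) → Vec (Fin k) (ar τ R) → FOC τ k
  eqᶠ    : Fin k → Fin k → FOC τ k
  negᶠ   : FOC τ k → FOC τ k
  andᶠ   : FOC τ k → FOC τ k → FOC τ k
  orᶠ    : FOC τ k → FOC τ k → FOC τ k
  exᶠ    : Fin k → FOC τ k → FOC τ k
  faᶠ    : Fin k → FOC τ k → FOC τ k
  exGeᶠ  : ℕ → Fin k → FOC τ k → FOC τ k

WS-FOC : {τ : Vocab} {k : ℕ} → Subset k → FOC τ k → Set
WS-FOC Γ (relᶠ R xs) = ∀ i → lookup xs i ∈ Γ
WS-FOC Γ (eqᶠ x y) = (x ∈ Γ) × (y ∈ Γ)
WS-FOC Γ (negᶠ φ) = WS-FOC Γ φ
WS-FOC Γ (andᶠ φ ψ) = WS-FOC Γ φ × WS-FOC Γ ψ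
WS-FOC Γ (orᶠ φ ψ) = WS-FOC Γ φ × WS-FOC Γ ψ
WS-FOC Γ (exᶠ x φ) = WS-FOC (Γ [ x ]≔ inside) φ
WS-FOC Γ (faᶠ x φ) = WS-FOC (Γ [ x ]≔ inside) φ
WS-FOC Γ (exGeᶠ i x φ) = WS-FOC (Γ [ x ]≔ inside) φ

satF : {τ : Vocab} {k : ℕ} (𝔄 : Struct τ) → FOC τ k → Vec (U 𝔄) k → Set
satF 𝔄 (relᶠ R xs) ρ = rel 𝔄 R (map (lookup ρ) xs)
satF 𝔄 (eqᶠ x y) ρ = lookup ρ x ≡ lookup ρ y
satF 𝔄 (negᶠ φ) ρ = ¬ satF 𝔄 φ ρ
satF 𝔄 (andᶠ φ ψ) ρ = satF 𝔄 φ ρ × satF 𝔄 ψ ρ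
satF 𝔄 (orᶠ φ ψ) ρ = satF 𝔄 φ ρ ⊎ satF 𝔄 ψ ρ
satF 𝔄 (exᶠ x φ) ρ = ∃ λ a → satF 𝔄 φ (ρ [ x ]≔ a)
satF 𝔄 (faᶠ x φ) ρ = ∀ a → satF 𝔄 φ (ρ [ x ]≔ a)
satF 𝔄 (exGeᶠ i x φ) ρ =
  Σ (Fin i → U 𝔄) λ f → Injective _≡_ _≡_ f × (∀ j → satF 𝔄 φ (ρ [ x ]≔ f j))

-- Σ^1_1(FOC^k) sentences  ∃X_1 … ∃X_m χ  with χ an FOC^k-sentence

record ESO (τ : Vocab) (k : ℕ) : Set₁ where
  field
    arities : List ℕ
    body    : FOC (τ ⊕ listVoc arities) k
    closed  : WS-FOC ⊥ body
open ESO public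

_⊨ESO_ : {τ : Vocab} {k : ℕ} → Struct τ → ESO τ k → Set₁
𝔄 ⊨ESO φ =
  Σ ((j : Fin (length (arities φ))) → Vec (U 𝔄) (L.lookup (arities φ) j) → Set) λ I →
    ∀ ρ → satF (expand 𝔄 I) (body φ) ρ

IsoClosed : (ts : List ℕ) →
  ((A : Set) → ((j : Fin (length ts)) → Vec A (L.lookup ts j) → Set) → Set) → Set₁
IsoClosed ts Q =
  ∀ {A A' : Set} (f : A ⤖ A') B B' →
    (∀ j t → (B j t → B' j (map (Bijection.to f) t)) × (B' j (map (Bijection.to f) t) → B j t)) →
    Q A B → Q A' B'

record GQ : Set₁ where
  field
    type     : List ℕ
    Q        : (A : Set) → ((j : Fin (length type)) → Vec A (L.lookup type j) → Set) → Set
    isoClosed : IsoClosed type Q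
open GQ public

-- Teams (lax semantics). Variables x_1..x_m are Fin m; an assignment with
-- domain D ⊆ {x_1..x_m} is a vector of Maybe-values, defined exactly on D.

Assign : Set → ℕ → Set
Assign A m = Vec (Maybe A) m

Team : Set → ℕ → Set₁
Team A m = Assign A m → Set

HasDomain : {A : Set} {m : ℕ} → Team A m → Subset m → Set
HasDomain X D = ∀ s → X s → ∀ i → (i ∈ D → Is-just (lookup s i)) × (Is-just (lookup s i) → i ∈ D)

relT : {A : Set} {m n : ℕ} → Team A m → Vec (Fin m) n → Vec A n → Set
relT X ys t = ∃ λ s → X s × map (lookup s) ys ≡ map just t

tupleStruct : (ts : List ℕ) (A : Set) → A →
  ((j : Fin (length ts)) → Vec A (L.lookup ts j) → Set) → Struct (listVoc ts)
tupleStruct ts A a B = record { U = A ; elem = a ; rel = B }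

Definable : ℕ → GQ → Set₁
Definable k G =
  (∀ j → L.lookup (type G) j ≤ k) ×
  Σ (ESO (listVoc (type G)) k) λ φ →
    ∀ (A : Set) (a : A) (m : ℕ) (X : Team A m) (D : Subset m) → HasDomain X D →
    (xs : (j : Fin (length (type G))) → Vec (Fin m) (L.lookup (type G) j)) →
    (∀ j i → lookup (xs j) i ∈ D) →
    (Q G A (λ j → relT X (xs j)) → tupleStruct (type G) A a (λ j → relT X (xs j)) ⊨ESO φ) ×
    (tupleStruct (type G) A a (λ j → relT X (xs j)) ⊨ESO φ → Q G A (λ j → relT X (xs j)))

-- FO^k(A_Q) in negation normal form

data FOQ (τ : Vocab) (k : ℕ) (G : GQ) : Set where
  relᵗ   : (R : Sym τ) → Vec (Fin k) (ar τ R) → FOQ τ k G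
  nrelᵗ  : (R : Sym τ) → Vec (Fin k) (ar τ R) → FOQ τ k G
  eqᵗ    : Fin k → Fin k → FOQ τ k G
  neqᵗ   : Fin k → Fin k → FOQ τ k G
  andᵗ   : FOQ τ k G → FOQ τ k G → FOQ τ k G
  orᵗ    : FOQ τ k G → FOQ τ k G → FOQ τ k G
  exᵗ    : Fin k → FOQ τ k G → FOQ τ k G
  faᵗ    : Fin k → FOQ τ k G → FOQ τ k G
  gatomᵗ : ((j : Fin (length (type G))) → Vec (Fin k) (L.lookup (type G) j)) → FOQ τ k G

WS-FOQ : {τ : Vocab} {k : ℕ} {G : GQ} → Subset k → FOQ τ k G → Set
WS-FOQ Γ (relᵗ R xs) = ∀ i → lookup xs i ∈ Γ
WS-FOQ Γ (nrelᵗ R xs) = ∀ i → lookup xs i ∈ Γ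
WS-FOQ Γ (eqᵗ x y) = (x ∈ Γ) × (y ∈ Γ)
WS-FOQ Γ (neqᵗ x y) = (x ∈ Γ) × (y ∈ Γ)
WS-FOQ Γ (andᵗ φ ψ) = WS-FOQ Γ φ × WS-FOQ Γ ψ
WS-FOQ Γ (orᵗ φ ψ) = WS-FOQ Γ φ × WS-FOQ Γ ψ
WS-FOQ Γ (exᵗ x φ) = WS-FOQ (Γ [ x ]≔ inside) φ
WS-FOQ Γ (faᵗ x φ) = WS-FOQ (Γ [ x ]≔ inside) φ
WS-FOQ {G = G} Γ (gatomᵗ xs) = ∀ j i → lookup (xs j) i ∈ Γ

satT : {τ : Vocab} {k : ℕ} {G : GQ} (𝔄 : Struct τ) → FOQ τ k G → Team (U 𝔄) k → Set₁
satT 𝔄 (relᵗ R xs) X =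
  ∀ s → X s → Level.Lift _ (∃ λ t → map (lookup s) xs ≡ map just t × rel 𝔄 R t)
satT 𝔄 (nrelᵗ R xs) X =
  ∀ s → X s → Level.Lift _ (∃ λ t → map (lookup s) xs ≡ map just t × ¬ rel 𝔄 R t)
satT 𝔄 (eqᵗ x y) X =
  ∀ s → X s → Level.Lift _ (∃ λ a → lookup s x ≡ just a × lookup s y ≡ just a)
satT 𝔄 (neqᵗ x y) X =
  ∀ s → X s → Level.Lift _ (∃₂ λ a b → lookup s x ≡ just a × lookup s y ≡ just b × a ≢ b)
satT 𝔄 (andᵗ φ ψ) X = satT 𝔄 φ X × satT 𝔄 ψ X
satT 𝔄 (orᵗ φ ψ) X =
  Σ (Team (U 𝔄) _) λ Y → Σ (Team (U 𝔄) _) λ Z →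
    (∀ s → (X s → Y s ⊎ Z s) × (Y s ⊎ Z s → X s)) × satT 𝔄 φ Y × satT 𝔄 ψ Z
satT 𝔄 (exᵗ x φ) X =
  Σ (Assign (U 𝔄) _ → U 𝔄 → Set) λ F →
    (∀ s → X s → ∃ (F s)) ×
    satT 𝔄 φ (λ t → ∃₂ λ s a → X s × F s a × t ≡ s [ x ]≔ just a)
satT 𝔄 (faᵗ x φ) X =
  satT 𝔄 φ (λ t → ∃₂ λ s a → X s × t ≡ s [ x ]≔ just a)
satT {G = G} 𝔄 (gatomᵗ xs) X = Level.Lift _ (Q G (U 𝔄) (λ j → relT X (xs j)))

-- truth of a sentence: satisfied by the team {∅}
_⊨Q_ : {τ : Vocab} {k : ℕ} {G : GQ} → Struct τ → FOQ τ k G → Set₁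
_⊨Q_ {k = k} 𝔄 φ = satT 𝔄 φ (λ s → s ≡ replicate k nothing)

-- A team X with domain D ⊆ {x_1,…,x_k} is represented by the k-ary relation
-- T = {a : a↾D ∈ X} on total assignments; such T are exactly the D-invariant
-- relations.  The team operations become FOC^k conditions on representations:
-- X = Y ∪ Z becomes T = T_Y ∪ T_Z, supplementing or duplicating by x becomes a
-- condition involving ∃x, and rel(X, x̄) becomes the projection of T onto x̄, which
-- FOC^k can pin down with k variables (the projection axiom).  So a formula φ is
-- translated, relative to D, into an FOC^k formula tr D φ over τ expanded by a
-- team symbol 𝕋 and auxiliary symbols, with: X ⊨ φ iff some expansion in which 𝕋
-- represents X makes tr D φ valid (Correctness.correct, by induction on φ).  The
-- team {∅} is represented by the full relation, so φ is equivalent to the sentence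
-- ∃𝕋 ∃aux ∀x̄ (𝕋(x̄) ∧ tr ∅ φ).  Implications are read classically (excluded middle).

module Submission where

open import Defs
open import Level using (0ℓ; Lift; lift; lower)
open import Axiom.ExcludedMiddle using (ExcludedMiddle)
open import Data.Nat using (ℕ; zero; suc; _≤_; s≤s)
open import Data.Fin using (Fin; zero; suc; _≟_; inject≤)
open import Data.Fin.Properties using (inject≤-injective)
open import Data.Fin.Subset using (Subset; inside; _∈_; _∉_; ⊥)
open import Data.Fin.Subset.Properties using (_∈?_; ∉⊥)
open import Data.Vec using (Vec; []; _∷_; lookup; tabulate; map; replicate; allFin; _[_]≔_; head; tail)
open import Data.Vec.Properties
  using (lookup∘tabulate; lookup-map; lookup∘update; lookup∘update′; lookup-replicate;
         []≔-idempotent; []≔-lookup; map-lookup-allFin; []=⇒lookup; lookup⇒[]=)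
open import Data.Vec.Relation.Binary.Pointwise.Extensional using (ext; Pointwise-≡⇒≡)
open import Data.Vec.Membership.Propositional using () renaming (_∈_ to _∈ᵥ_)
open import Data.Vec.Membership.Propositional.Properties using (∈-lookup)
open import Data.Vec.Relation.Unary.Any using (here; there; any?)
open import Data.List using (List; []; _∷_; length; _++_; filter)
import Data.List as L
open import Data.List.Membership.Propositional using () renaming (_∈_ to _∈ₗ_; _∉_ to _∉ₗ_)
open import Data.List.Membership.Propositional.Properties using (∈-allFin; ∈-filter⁺; ∈-filter⁻)
open import Data.List.Relation.Unary.Any using () renaming (here to hereₗ; there to thereₗ)
open import Data.Maybe using (Maybe; just; nothing; fromMaybe; Is-just)
open import Data.Maybe.Properties using (just-injective)
open import Data.Maybe.Relation.Unary.Any using () renaming (just to isJust)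
open import Data.Product using (Σ; ∃; ∃₂; _×_; _,_; proj₁; proj₂)
open import Data.Sum using (_⊎_; inj₁; inj₂)
open import Data.Empty using (⊥-elim)
open import Data.Unit using (tt)
open import Function.Bundles using (_⇔_; mk⇔; Equivalence)
open import Data.Product.Function.NonDependent.Propositional using (_×-⇔_)
open import Data.Sum.Function.Propositional using (_⊎-⇔_)
open import Function.Related.TypeIsomorphisms using (→-cong-⇔; ¬-cong-⇔)
open import Function.Construct.Identity using (⇔-id)
open import Function.Construct.Symmetry using (⇔-sym)
open import Function.Construct.Composition using (_⇔-∘_)
open import Relation.Nullary using (¬_; Dec; yes; no; does; ¬?; contradiction)
open import Data.Bool using (if_then_else_)
open import Relation.Unary using (Decidable)
open import Relation.Binary.PropositionalEquality
  using (_≡_; _≢_; refl; sym; trans; cong; cong₂; subst; module ≡-Reasoning)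

open Equivalence using (to; from)

private
  variable
    A : Set
    k m n : ℕ
    σ τ : Vocab
    l l₁ l₂ : List ℕ

lookup-ext : {u v : Vec A n} → (∀ i → lookup u i ≡ lookup v i) → u ≡ v
lookup-ext p = Pointwise-≡⇒≡ (ext p)

map-just-injective : {u v : Vec A n} → map just u ≡ map just v → u ≡ v
map-just-injective {u = []}    {[]}    _ = refl
map-just-injective {u = _ ∷ _} {_ ∷ _} e =
  cong₂ _∷_ (just-injective (cong head e)) (map-just-injective (cong tail e))

map-subst : {B C : Set} (g : B → C) (p : m ≡ n) (v : Vec B m) →
            map g (subst (Vec B) p v) ≡ subst (Vec C) p (map g v)
map-subst g refl v = refl

allFin-atom : (P : Vec A k → Set) (ρ : Vec A k) → P (map (lookup ρ) (allFin k)) ⇔ P ρ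
allFin-atom P ρ = mk⇔ (subst P (map-lookup-allFin ρ)) (subst P (sym (map-lookup-allFin ρ)))

AgreeOn : (Fin k → Set) → Vec A k → Vec A k → Set
AgreeOn P a b = ∀ i → P i → lookup a i ≡ lookup b i

Invariant : Subset k → (Vec A k → Set) → Set
Invariant D P = ∀ a b → AgreeOn (_∈ D) a b → P b → P a

∃ᵛ : Fin k → (Vec A k → Set) → Vec A k → Set
∃ᵛ x P ρ = ∃ λ c → P (ρ [ x ]≔ c)

∃-cong-⇔ : {X : Set} {B C : X → Set} → (∀ x → B x ⇔ C x) → Σ X B ⇔ Σ X C
∃-cong-⇔ h = mk⇔ (λ (x , b) → x , to (h x) b) (λ (x , c) → x , from (h x) c)

∀-cong-⇔ : {X : Set} {B C : X → Set} → (∀ x → B x ⇔ C x) → ((x : X) → B x) ⇔ ((x : X) → C x)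
∀-cong-⇔ h = mk⇔ (λ f x → to (h x) (f x)) (λ g x → from (h x) (g x))

outsideOf : {P : Fin k → Set} → Decidable P → List (Fin k)
outsideOf {k = k} P? = filter (λ v → ¬? (P? v)) (L.allFin k)

module _ {σ : Vocab} {k : ℕ} where

  infixr 6 _⇒ᶠ_ _⇔ᶠ_

  _⇒ᶠ_ : FOC σ k → FOC σ k → FOC σ k
  φ ⇒ᶠ ψ = orᶠ (negᶠ φ) ψ

  _⇔ᶠ_ : FOC σ k → FOC σ k → FOC σ k
  φ ⇔ᶠ ψ = andᶠ (φ ⇒ᶠ ψ) (ψ ⇒ᶠ φ)

  ∃⃗ ∀⃗ : List (Fin k) → FOC σ k → FOC σ k
  ∃⃗ []      φ = φ
  ∃⃗ (x ∷ l) φ = exᶠ x (∃⃗ l φ)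
  ∀⃗ []      φ = φ
  ∀⃗ (x ∷ l) φ = faᶠ x (∀⃗ l φ)

  closure : FOC σ k → FOC σ k
  closure = ∀⃗ (L.allFin k)

  ⊤ᶠ : Fin k → FOC σ k
  ⊤ᶠ x = eqᶠ x x

  ⋀ : Fin k → (n : ℕ) → (Fin n → FOC σ k) → FOC σ k
  ⋀ x zero    φs = ⊤ᶠ x
  ⋀ x (suc n) φs = andᶠ (φs zero) (⋀ x n (λ i → φs (suc i)))

  -- φ → ∀(variables outside D) φ : the relation defined by φ depends only on D
  cylinder : Subset k → FOC σ k → FOC σ k
  cylinder D φ = φ ⇒ᶠ ∀⃗ (outsideOf (_∈? D)) φ

module FOCSemantics (em : ExcludedMiddle 0ℓ) (𝔅 : Struct σ) where

  Valid : FOC σ k → Set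
  Valid φ = ∀ ρ → satF 𝔅 φ ρ

  Defines : FOC σ k → (Vec (U 𝔅) k → Set) → Set
  Defines φ P = ∀ ρ → satF 𝔅 φ ρ ⇔ P ρ

  ⇒ᶠ-sem : (φ ψ : FOC σ k) (ρ : Vec (U 𝔅) k) →
           satF 𝔅 (φ ⇒ᶠ ψ) ρ ⇔ (satF 𝔅 φ ρ → satF 𝔅 ψ ρ)
  ⇒ᶠ-sem φ ψ ρ = mk⇔ apply material
    where
    apply : satF 𝔅 (φ ⇒ᶠ ψ) ρ → satF 𝔅 φ ρ → satF 𝔅 ψ ρ
    apply (inj₁ ¬φ) sφ = contradiction sφ ¬φ
    apply (inj₂ sψ) _  = sψ
    material : (satF 𝔅 φ ρ → satF 𝔅 ψ ρ) → satF 𝔅 (φ ⇒ᶠ ψ) ρ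
    material f with em {satF 𝔅 φ ρ}
    ... | yes sφ = inj₂ (f sφ)
    ... | no ¬φ  = inj₁ ¬φ

  AgreeOff : List (Fin k) → Vec (U 𝔅) k → Vec (U 𝔅) k → Set
  AgreeOff l ρ′ ρ = ∀ v → v ∉ₗ l → lookup ρ′ v ≡ lookup ρ v

  private
    agreeOff-step : ∀ x l (ρ ρ′ : Vec (U 𝔅) k) c →
                    AgreeOff l ρ′ (ρ [ x ]≔ c) → AgreeOff (x ∷ l) ρ′ ρ
    agreeOff-step x l ρ ρ′ c h v v∉ =
      trans (h v (λ v∈ → v∉ (thereₗ v∈))) (lookup∘update′ (λ v≡x → v∉ (hereₗ v≡x)) ρ c)

    agreeOff-unstep : ∀ x l (ρ ρ′ : Vec (U 𝔅) k) →
                      AgreeOff (x ∷ l) ρ′ ρ → AgreeOff l ρ′ (ρ [ x ]≔ lookup ρ′ x)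
    agreeOff-unstep x l ρ ρ′ h v v∉ with v ≟ x
    ... | yes refl = sym (lookup∘update v ρ (lookup ρ′ v))
    ... | no v≢x   = trans (h v λ { (hereₗ v≡x) → v≢x v≡x ; (thereₗ v∈) → v∉ v∈ })
                           (sym (lookup∘update′ v≢x ρ _))

  ∃⃗-sem : ∀ l φ (ρ : Vec (U 𝔅) k) →
          satF 𝔅 (∃⃗ l φ) ρ ⇔ ∃ λ ρ′ → AgreeOff l ρ′ ρ × satF 𝔅 φ ρ′
  ∃⃗-sem []      φ ρ = mk⇔ (λ s → ρ , (λ _ _ → refl) , s)
                            (λ (ρ′ , ag , s) → subst (satF 𝔅 φ) (lookup-ext λ v → ag v λ ()) s)
  ∃⃗-sem (x ∷ l) φ ρ = mk⇔
    (λ (c , s) → let (ρ′ , ag , s′) = to (∃⃗-sem l φ (ρ [ x ]≔ c)) s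
                 in ρ′ , agreeOff-step x l ρ ρ′ c ag , s′)
    (λ (ρ′ , ag , s) → lookup ρ′ x ,
       from (∃⃗-sem l φ (ρ [ x ]≔ lookup ρ′ x)) (ρ′ , agreeOff-unstep x l ρ ρ′ ag , s))

  ∀⃗-sem : ∀ l φ (ρ : Vec (U 𝔅) k) →
          satF 𝔅 (∀⃗ l φ) ρ ⇔ (∀ ρ′ → AgreeOff l ρ′ ρ → satF 𝔅 φ ρ′)
  ∀⃗-sem []      φ ρ = mk⇔ (λ s ρ′ ag → subst (satF 𝔅 φ) (sym (lookup-ext λ v → ag v λ ())) s)
                            (λ f → f ρ (λ _ _ → refl))
  ∀⃗-sem (x ∷ l) φ ρ = mk⇔
    (λ s ρ′ ag → to (∀⃗-sem l φ (ρ [ x ]≔ lookup ρ′ x)) (s (lookup ρ′ x)) ρ′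
                    (agreeOff-unstep x l ρ ρ′ ag))
    (λ f c → from (∀⃗-sem l φ (ρ [ x ]≔ c)) λ ρ′ ag → f ρ′ (agreeOff-step x l ρ ρ′ c ag))

  agreeOff-outsideOf : {P : Fin k → Set} (P? : Decidable P) (ρ′ ρ : Vec (U 𝔅) k) →
                       AgreeOff (outsideOf P?) ρ′ ρ ⇔ AgreeOn P ρ′ ρ
  agreeOff-outsideOf {P = P} P? ρ′ ρ = mk⇔
    (λ h v p → h v λ v∈ → proj₂ (∈-filter⁻ (λ u → ¬? (P? u)) {xs = L.allFin _} v∈) p)
    (λ g v v∉ → g v (kept v v∉))
    where
    kept : ∀ v → v ∉ₗ outsideOf P? → P v
    kept v v∉ with P? v
    ... | yes p = p
    ... | no ¬p = ⊥-elim (v∉ (∈-filter⁺ (λ u → ¬? (P? u)) (∈-allFin v) ¬p))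

  ∃-outside-sem : {P : Fin k → Set} (P? : Decidable P) (φ : FOC σ k) (ρ : Vec (U 𝔅) k) →
                  satF 𝔅 (∃⃗ (outsideOf P?) φ) ρ ⇔ ∃ λ ρ′ → AgreeOn P ρ′ ρ × satF 𝔅 φ ρ′
  ∃-outside-sem P? φ ρ =
    ∃-cong-⇔ (λ ρ′ → agreeOff-outsideOf P? ρ′ ρ ×-⇔ ⇔-id _) ⇔-∘ ∃⃗-sem (outsideOf P?) φ ρ

  ∀-outside-sem : {P : Fin k → Set} (P? : Decidable P) (φ : FOC σ k) (ρ : Vec (U 𝔅) k) →
                  satF 𝔅 (∀⃗ (outsideOf P?) φ) ρ ⇔ (∀ ρ′ → AgreeOn P ρ′ ρ → satF 𝔅 φ ρ′)
  ∀-outside-sem P? φ ρ =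
    ∀-cong-⇔ (λ ρ′ → →-cong-⇔ (agreeOff-outsideOf P? ρ′ ρ) (⇔-id _)) ⇔-∘ ∀⃗-sem (outsideOf P?) φ ρ

  closure-sem : ∀ φ (ρ : Vec (U 𝔅) k) → satF 𝔅 (closure φ) ρ ⇔ Valid φ
  closure-sem φ ρ = mk⇔ (λ s ρ′ → to (∀⃗-sem (L.allFin _) φ ρ) s ρ′ λ v v∉ → ⊥-elim (v∉ (∈-allFin v)))
                  (λ v → from (∀⃗-sem (L.allFin _) φ ρ) λ ρ′ _ → v ρ′)

  ⇒-valid : (φ ψ : FOC σ k) {P Q : Vec (U 𝔅) k → Set} →
            Defines φ P → Defines ψ Q → Valid (φ ⇒ᶠ ψ) ⇔ (∀ ρ → P ρ → Q ρ)
  ⇒-valid φ ψ dφ dψ = ∀-cong-⇔ λ ρ → →-cong-⇔ (dφ ρ) (dψ ρ) ⇔-∘ ⇒ᶠ-sem φ ψ ρ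

  ⇔-valid : (φ ψ : FOC σ k) {P Q : Vec (U 𝔅) k → Set} →
            Defines φ P → Defines ψ Q → Valid (φ ⇔ᶠ ψ) ⇔ (∀ ρ → P ρ ⇔ Q ρ)
  ⇔-valid φ ψ dφ dψ = mk⇔
    (λ v ρ → mk⇔ (to (⇒-valid φ ψ dφ dψ) (λ ρ → proj₁ (v ρ)) ρ)
                 (to (⇒-valid ψ φ dψ dφ) (λ ρ → proj₂ (v ρ)) ρ))
    (λ e ρ → from (⇒-valid φ ψ dφ dψ) (λ ρ → to (e ρ)) ρ , from (⇒-valid ψ φ dψ dφ) (λ ρ → from (e ρ)) ρ)

  ∨-defines : (φ ψ : FOC σ k) {P Q : Vec (U 𝔅) k → Set} →
              Defines φ P → Defines ψ Q → Defines (orᶠ φ ψ) (λ ρ → P ρ ⊎ Q ρ)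
  ∨-defines φ ψ dφ dψ ρ = dφ ρ ⊎-⇔ dψ ρ

  ∃-defines : (x : Fin k) (φ : FOC σ k) {P : Vec (U 𝔅) k → Set} →
              Defines φ P → Defines (exᶠ x φ) (∃ᵛ x P)
  ∃-defines x φ dφ ρ = ∃-cong-⇔ λ c → dφ (ρ [ x ]≔ c)

  cylinder-valid : (D : Subset k) (φ : FOC σ k) {P : Vec (U 𝔅) k → Set} →
                   Defines φ P → Valid (cylinder D φ) ⇔ Invariant D P
  cylinder-valid {k = k} D φ dφ = mk⇔
    (λ v a b ag pb → to (dφ a)
       (to (∀-outside-sem (_∈? D) φ b) (to (⇒ᶠ-sem φ ψ b) (v b) (from (dφ b) pb)) a ag))
    (λ inv ρ → from (⇒ᶠ-sem φ ψ ρ) λ sρ → from (∀-outside-sem (_∈? D) φ ρ) λ ρ′ ag →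
       from (dφ ρ′) (inv ρ′ ρ ag (to (dφ ρ) sρ)))
    where
    ψ : FOC σ k
    ψ = ∀⃗ (outsideOf (_∈? D)) φ

  ∧-valid : (φ ψ : FOC σ k) → Valid (andᶠ φ ψ) ⇔ (Valid φ × Valid ψ)
  ∧-valid φ ψ = mk⇔ (λ v → (λ ρ → proj₁ (v ρ)) , (λ ρ → proj₂ (v ρ))) (λ (vφ , vψ) ρ → vφ ρ , vψ ρ)

  ∧₃-valid : (φ ψ χ : FOC σ k) → Valid (andᶠ φ (andᶠ ψ χ)) ⇔ (Valid φ × Valid ψ × Valid χ)
  ∧₃-valid φ ψ χ = (⇔-id _ ×-⇔ ∧-valid ψ χ) ⇔-∘ ∧-valid φ (andᶠ ψ χ)

  ⋀-valid : ∀ x n (φs : Fin n → FOC σ k) → Valid (⋀ x n φs) ⇔ (∀ i → Valid (φs i))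
  ⋀-valid x zero    φs = mk⇔ (λ _ ()) (λ _ _ → refl)
  ⋀-valid x (suc n) φs = mk⇔
    (λ v → λ { zero → λ ρ → proj₁ (v ρ) ; (suc i) → to (⋀-valid x n _) (λ ρ → proj₂ (v ρ)) i })
    (λ vs ρ → vs zero ρ , from (⋀-valid x n _) (λ i → vs (suc i)) ρ)

withRel : {σ′ : Vocab} (𝔅 : Struct σ′) → ((R : Sym σ) → Vec (U 𝔅) (ar σ R) → Set) → Struct σ
withRel 𝔅 r = record { U = U 𝔅 ; elem = elem 𝔅 ; rel = r }

module _ {σ σ′ : Vocab} (f : Sym σ → Sym σ′) (f-ar : ∀ R → ar σ′ (f R) ≡ ar σ R) where

  rename : FOC σ k → FOC σ′ k
  rename (relᶠ R xs)   = relᶠ (f R) (subst (Vec (Fin _)) (sym (f-ar R)) xs)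
  rename (eqᶠ x y)     = eqᶠ x y
  rename (negᶠ φ)      = negᶠ (rename φ)
  rename (andᶠ φ ψ)    = andᶠ (rename φ) (rename ψ)
  rename (orᶠ φ ψ)     = orᶠ (rename φ) (rename ψ)
  rename (exᶠ x φ)     = exᶠ x (rename φ)
  rename (faᶠ x φ)     = faᶠ x (rename φ)
  rename (exGeᶠ i x φ) = exGeᶠ i x (rename φ)

  rename-sem : (𝔅 : Struct σ′) (r : (R : Sym σ) → Vec (U 𝔅) (ar σ R) → Set) →
               (∀ R v → rel 𝔅 (f R) (subst (Vec (U 𝔅)) (sym (f-ar R)) v) ⇔ r R v) →
               ∀ (φ : FOC σ k) ρ → satF 𝔅 (rename φ) ρ ⇔ satF (withRel 𝔅 r) φ ρ
  rename-sem 𝔅 r hyp = sem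
    where
    sem : ∀ (φ : FOC σ k) ρ → satF 𝔅 (rename φ) ρ ⇔ satF (withRel 𝔅 r) φ ρ
    sem (relᶠ R xs) ρ rewrite map-subst (lookup ρ) (sym (f-ar R)) xs = hyp R (map (lookup ρ) xs)
    sem (eqᶠ x y)     ρ = ⇔-id _
    sem (negᶠ φ)      ρ = ¬-cong-⇔ (sem φ ρ)
    sem (andᶠ φ ψ)    ρ = sem φ ρ ×-⇔ sem ψ ρ
    sem (orᶠ φ ψ)     ρ = sem φ ρ ⊎-⇔ sem ψ ρ
    sem (exᶠ x φ)     ρ = ∃-cong-⇔ λ c → sem φ (ρ [ x ]≔ c)
    sem (faᶠ x φ)     ρ = ∀-cong-⇔ λ c → sem φ (ρ [ x ]≔ c)
    sem (exGeᶠ i x φ) ρ = ∃-cong-⇔ λ g → ⇔-id _ ×-⇔ ∀-cong-⇔ λ j → sem φ (ρ [ x ]≔ g j)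

satF-cong : (𝔅 : Struct σ) (r : (R : Sym σ) → Vec (U 𝔅) (ar σ R) → Set) →
            (∀ R v → rel 𝔅 R v ⇔ r R v) → ∀ (φ : FOC σ k) ρ → satF 𝔅 φ ρ ⇔ satF (withRel 𝔅 r) φ ρ
satF-cong 𝔅 r hyp φ ρ =
  rename-sem (λ R → R) (λ _ → refl) 𝔅 r hyp φ ρ
  ⇔-∘ ⇔-sym (rename-sem (λ R → R) (λ _ → refl) 𝔅 (rel 𝔅) (λ _ _ → ⇔-id _) φ ρ)

∈-added : (D : Subset k) (x : Fin k) → x ∈ D [ x ]≔ inside
∈-added D x = lookup⇒[]= x _ (lookup∘update x D inside)

∈-added⁺ : {D : Subset k} {i : Fin k} (x : Fin k) → i ∈ D → i ∈ D [ x ]≔ inside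
∈-added⁺ {D = D} {i} x i∈D with i ≟ x
... | yes refl = ∈-added D i
... | no i≢x   = lookup⇒[]= i _ (trans (lookup∘update′ i≢x D inside) ([]=⇒lookup i∈D))

∈-added⁻ : {D : Subset k} {i x : Fin k} → i ≢ x → i ∈ D [ x ]≔ inside → i ∈ D
∈-added⁻ {D = D} {i} i≢x i∈ = lookup⇒[]= i D (trans (sym (lookup∘update′ i≢x D inside)) ([]=⇒lookup i∈))

ws-all : (Γ : Subset k) → (∀ i → i ∈ Γ) → (φ : FOC σ k) → WS-FOC Γ φ
ws-all Γ all (relᶠ R xs)   = λ i → all _
ws-all Γ all (eqᶠ x y)     = all x , all y
ws-all Γ all (negᶠ φ)      = ws-all Γ all φ
ws-all Γ all (andᶠ φ ψ)    = ws-all Γ all φ , ws-all Γ all ψ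
ws-all Γ all (orᶠ φ ψ)     = ws-all Γ all φ , ws-all Γ all ψ
ws-all Γ all (exᶠ x φ)     = ws-all _ (λ i → ∈-added⁺ x (all i)) φ
ws-all Γ all (faᶠ x φ)     = ws-all _ (λ i → ∈-added⁺ x (all i)) φ
ws-all Γ all (exGeᶠ n x φ) = ws-all _ (λ i → ∈-added⁺ x (all i)) φ

ws-∀⃗ : (l : List (Fin k)) (Γ : Subset k) → (∀ i → i ∈ₗ l ⊎ i ∈ Γ) → (φ : FOC σ k) → WS-FOC Γ (∀⃗ l φ)
ws-∀⃗ []      Γ cover φ = ws-all Γ (λ i → inScope (cover i)) φ
  where
  inScope : ∀ {i} → i ∈ₗ [] ⊎ i ∈ Γ → i ∈ Γ
  inScope (inj₂ i∈Γ) = i∈Γ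
ws-∀⃗ (x ∷ l) Γ cover φ = ws-∀⃗ l (Γ [ x ]≔ inside) cover′ φ
  where
  cover′ : ∀ i → i ∈ₗ l ⊎ i ∈ Γ [ x ]≔ inside
  cover′ i with i ≟ x | cover i
  ... | yes refl | _                 = inj₂ (∈-added Γ i)
  ... | no i≢x   | inj₁ (hereₗ i≡x)  = ⊥-elim (i≢x i≡x)
  ... | no _     | inj₁ (thereₗ i∈l) = inj₁ i∈l
  ... | no _     | inj₂ i∈Γ          = inj₂ (∈-added⁺ x i∈Γ)

closure-closed : (φ : FOC σ k) → WS-FOC ⊥ (closure φ)
closure-closed φ = ws-∀⃗ (L.allFin _) ⊥ (λ i → inj₁ (∈-allFin i)) φ

record Interp (A : Set) (l : List ℕ) : Set₁ where
  constructor interp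
  field rels : (j : Fin (length l)) → Vec A (L.lookup l j) → Set
open Interp

infixr 5 _◂_
_◂_ : (Vec A n → Set) → Interp A l → Interp A (n ∷ l)
rels (T ◂ I) zero    = T
rels (T ◂ I) (suc j) = rels I j

tailᴵ : Interp A (n ∷ l) → Interp A l
rels (tailᴵ I) j = rels I (suc j)

infix 4 _≈ᴵ_
_≈ᴵ_ : Interp A l → Interp A l → Set
I ≈ᴵ I′ = ∀ j v → rels I j v ⇔ rels I′ j v

infix 4 _↪_
record _↪_ (l₁ l : List ℕ) : Set where
  field
    pos    : Fin (length l₁) → Fin (length l)
    pos-ar : ∀ j → L.lookup l (pos j) ≡ L.lookup l₁ j
open _↪_

restrict : l₁ ↪ l → Interp A l → Interp A l₁
rels (restrict e I) j v = rels I (pos e j) (subst (Vec _) (sym (pos-ar e j)) v)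

↪-id : l ↪ l
↪-id = record { pos = λ j → j ; pos-ar = λ _ → refl }

↪-there : l₁ ↪ l → l₁ ↪ n ∷ l
↪-there e = record { pos = λ j → suc (pos e j) ; pos-ar = pos-ar e }

↪-keep : l₁ ↪ l → n ∷ l₁ ↪ n ∷ l
↪-keep {l₁ = l₁} {l = l} {n = n} e = record { pos = keepPos ; pos-ar = keepAr }
  where
  keepPos : Fin (length (n ∷ l₁)) → Fin (length (n ∷ l))
  keepPos zero    = zero
  keepPos (suc j) = suc (pos e j)
  keepAr : ∀ j → L.lookup (n ∷ l) (keepPos j) ≡ L.lookup (n ∷ l₁) j
  keepAr zero    = refl
  keepAr (suc j) = pos-ar e j

↪-inl : (l₁ : List ℕ) → l₁ ↪ l₁ ++ l₂
↪-inl []       = record { pos = λ () ; pos-ar = λ () }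
↪-inl (n ∷ l₁) = ↪-keep (↪-inl l₁)

↪-inr : (l₁ : List ℕ) → l₂ ↪ l₁ ++ l₂
↪-inr []       = ↪-id
↪-inr (n ∷ l₁) = ↪-there (↪-inr l₁)

join : (l₁ : List ℕ) → Interp A l₁ → Interp A l₂ → Interp A (l₁ ++ l₂)
join []       I₁ I₂ = I₂
join (n ∷ l₁) I₁ I₂ = rels I₁ zero ◂ join l₁ (tailᴵ I₁) I₂

restrict-inl-join : (l₁ : List ℕ) (I₁ : Interp A l₁) (I₂ : Interp A l₂) →
                    restrict (↪-inl l₁) (join l₁ I₁ I₂) ≈ᴵ I₁
restrict-inl-join (n ∷ l₁) I₁ I₂ zero    v = ⇔-id _
restrict-inl-join (n ∷ l₁) I₁ I₂ (suc j) v = restrict-inl-join l₁ (tailᴵ I₁) I₂ j v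

restrict-inr-join : (l₁ : List ℕ) (I₁ : Interp A l₁) (I₂ : Interp A l₂) →
                    restrict (↪-inr l₁) (join l₁ I₁ I₂) ≈ᴵ I₂
restrict-inr-join []       I₁ I₂ j v = ⇔-id _
restrict-inr-join (n ∷ l₁) I₁ I₂ j v = restrict-inr-join l₁ (tailᴵ I₁) I₂ j v

restrict-keep : (e : l₁ ↪ l) {T : Vec A n → Set} {I : Interp A l} {J : Interp A (n ∷ l₁)} →
                (∀ v → T v ⇔ rels J zero v) → restrict e I ≈ᴵ tailᴵ J → restrict (↪-keep e) (T ◂ I) ≈ᴵ J
restrict-keep e T⇔J₀ I≈J zero    = T⇔J₀
restrict-keep e T⇔J₀ I≈J (suc j) = I≈J j

_⊕ᴸ_ : Vocab → List ℕ → Vocab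
τ ⊕ᴸ l = τ ⊕ listVoc l

expandᴵ : (𝔄 : Struct τ) → Interp (U 𝔄) l → Struct (τ ⊕ᴸ l)
expandᴵ 𝔄 I = expand 𝔄 (rels I)

embedSym : l₁ ↪ l → Sym (τ ⊕ᴸ l₁) → Sym (τ ⊕ᴸ l)
embedSym e (inj₁ R) = inj₁ R
embedSym e (inj₂ j) = inj₂ (pos e j)

embedSym-ar : (e : l₁ ↪ l) (R : Sym (τ ⊕ᴸ l₁)) → ar (τ ⊕ᴸ l) (embedSym {τ = τ} e R) ≡ ar (τ ⊕ᴸ l₁) R
embedSym-ar e (inj₁ R) = refl
embedSym-ar e (inj₂ j) = pos-ar e j

embed : l₁ ↪ l → FOC (τ ⊕ᴸ l₁) k → FOC (τ ⊕ᴸ l) k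
embed {τ = τ} e = rename (embedSym {τ = τ} e) (embedSym-ar {τ = τ} e)

embed-sem : (e : l₁ ↪ l) (𝔄 : Struct τ) (I : Interp (U 𝔄) l) (φ : FOC (τ ⊕ᴸ l₁) k) (ρ : Vec (U 𝔄) k) →
            satF (expandᴵ 𝔄 I) (embed e φ) ρ ⇔ satF (expandᴵ 𝔄 (restrict e I)) φ ρ
embed-sem {l₁ = l₁} {τ = τ} e 𝔄 I =
  rename-sem (embedSym {τ = τ} e) (embedSym-ar {τ = τ} e) (expandᴵ 𝔄 I) (rel (expandᴵ 𝔄 (restrict e I))) same
  where
  same : ∀ (R : Sym (τ ⊕ᴸ l₁)) v →
         rel (expandᴵ 𝔄 I) (embedSym {τ = τ} e R) (subst (Vec (U 𝔄)) (sym (embedSym-ar {τ = τ} e R)) v) ⇔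
         rel (expandᴵ 𝔄 (restrict e I)) R v
  same (inj₁ R) v = ⇔-id _
  same (inj₂ j) v = ⇔-id _

expand-cong : (𝔄 : Struct τ) (I I′ : Interp (U 𝔄) l) → I ≈ᴵ I′ →
              ∀ (φ : FOC (τ ⊕ᴸ l) k) ρ → satF (expandᴵ 𝔄 I) φ ρ ⇔ satF (expandᴵ 𝔄 I′) φ ρ
expand-cong {τ = τ} {l = l} 𝔄 I I′ I≈I′ = satF-cong (expandᴵ 𝔄 I) (rel (expandᴵ 𝔄 I′)) same
  where
  same : ∀ (R : Sym (τ ⊕ᴸ l)) v → rel (expandᴵ 𝔄 I) R v ⇔ rel (expandᴵ 𝔄 I′) R v
  same (inj₁ R) v = ⇔-id _
  same (inj₂ j) v = I≈I′ j v

embed-valid : (e : l₁ ↪ l) (𝔄 : Struct τ) (I : Interp (U 𝔄) l) (I₁ : Interp (U 𝔄) l₁) →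
              restrict e I ≈ᴵ I₁ → (φ : FOC (τ ⊕ᴸ l₁) k) →
              (∀ ρ → satF (expandᴵ 𝔄 I₁) φ ρ) → ∀ ρ → satF (expandᴵ 𝔄 I) (embed e φ) ρ
embed-valid e 𝔄 I I₁ sim φ v ρ = from (embed-sem e 𝔄 I φ ρ) (from (expand-cong 𝔄 _ I₁ sim φ ρ) (v ρ))

embed-valid⁻ : (e : l₁ ↪ l) (𝔄 : Struct τ) (I : Interp (U 𝔄) l) (φ : FOC (τ ⊕ᴸ l₁) k) →
               (∀ ρ → satF (expandᴵ 𝔄 I) (embed e φ) ρ) → ∀ ρ → satF (expandᴵ 𝔄 (restrict e I)) φ ρ
embed-valid⁻ e 𝔄 I φ v ρ = to (embed-sem e 𝔄 I φ ρ) (v ρ)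

atomVia : (e : l₁ ↪ l) (j : Fin (length l₁)) → Vec (Fin k) (L.lookup l₁ j) → FOC (τ ⊕ᴸ l) k
atomVia e j w = relᶠ (inj₂ (pos e j)) (subst (Vec (Fin _)) (sym (pos-ar e j)) w)

atomVia-sem : (e : l₁ ↪ l) (𝔄 : Struct τ) (I : Interp (U 𝔄) l) (j : Fin (length l₁))
              (w : Vec (Fin k) (L.lookup l₁ j)) (ρ : Vec (U 𝔄) k) →
              satF (expandᴵ 𝔄 I) (atomVia e j w) ρ ⇔ rels (restrict e I) j (map (lookup ρ) w)
atomVia-sem e 𝔄 I j w ρ rewrite map-subst (lookup ρ) (sym (pos-ar e j)) w = ⇔-id _

pairSym : l₁ ↪ l → l₂ ↪ l → Sym (listVoc l₁ ⊕ listVoc l₂) → Sym (τ ⊕ᴸ l)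
pairSym e₁ e₂ (inj₁ j) = inj₂ (pos e₁ j)
pairSym e₁ e₂ (inj₂ j) = inj₂ (pos e₂ j)

pairSym-ar : (e₁ : l₁ ↪ l) (e₂ : l₂ ↪ l) (R : Sym (listVoc l₁ ⊕ listVoc l₂)) →
             ar (τ ⊕ᴸ l) (pairSym {τ = τ} e₁ e₂ R) ≡ ar (listVoc l₁ ⊕ listVoc l₂) R
pairSym-ar e₁ e₂ (inj₁ j) = pos-ar e₁ j
pairSym-ar e₁ e₂ (inj₂ j) = pos-ar e₂ j

rename-pair : l₁ ↪ l → l₂ ↪ l → FOC (listVoc l₁ ⊕ listVoc l₂) k → FOC (τ ⊕ᴸ l) k
rename-pair {τ = τ} e₁ e₂ = rename (pairSym {τ = τ} e₁ e₂) (pairSym-ar {τ = τ} e₁ e₂)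

pairStruct : (l₁ : List ℕ) (A : Set) → A → Interp A l₁ → Interp A l₂ → Struct (listVoc l₁ ⊕ listVoc l₂)
pairStruct l₁ A a I₁ I₂ = expand (tupleStruct l₁ A a (rels I₁)) (rels I₂)

rename-pair-sem : (e₁ : l₁ ↪ l) (e₂ : l₂ ↪ l) (𝔄 : Struct τ) (I : Interp (U 𝔄) l)
                  (φ : FOC (listVoc l₁ ⊕ listVoc l₂) k) (ρ : Vec (U 𝔄) k) →
                  satF (expandᴵ 𝔄 I) (rename-pair e₁ e₂ φ) ρ ⇔
                  satF (pairStruct l₁ (U 𝔄) (elem 𝔄) (restrict e₁ I) (restrict e₂ I)) φ ρ
rename-pair-sem {l₁ = l₁} {l₂ = l₂} {τ = τ} e₁ e₂ 𝔄 I =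
  rename-sem (pairSym {τ = τ} e₁ e₂) (pairSym-ar {τ = τ} e₁ e₂) (expandᴵ 𝔄 I) (rel 𝔅) same
  where
  𝔅 : Struct (listVoc l₁ ⊕ listVoc l₂)
  𝔅 = pairStruct l₁ (U 𝔄) (elem 𝔄) (restrict e₁ I) (restrict e₂ I)
  same : ∀ R v →
         rel (expandᴵ 𝔄 I) (pairSym {τ = τ} e₁ e₂ R) (subst (Vec (U 𝔄)) (sym (pairSym-ar {τ = τ} e₁ e₂ R)) v) ⇔
         rel 𝔅 R v
  same (inj₁ j) v = ⇔-id _
  same (inj₂ j) v = ⇔-id _

pairStruct-cong : (l₁ : List ℕ) {A : Set} (a : A) {I₁ I₁′ : Interp A l₁} {I₂ I₂′ : Interp A l₂} →
                  I₁ ≈ᴵ I₁′ → I₂ ≈ᴵ I₂′ → ∀ (φ : FOC (listVoc l₁ ⊕ listVoc l₂) k) ρ →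
                  satF (pairStruct l₁ A a I₁ I₂) φ ρ ⇔ satF (pairStruct l₁ A a I₁′ I₂′) φ ρ
pairStruct-cong l₁ {A} a {I₁} {I₁′} {I₂} {I₂′} sim₁ sim₂ =
  satF-cong (pairStruct l₁ A a I₁ I₂) (rel (pairStruct l₁ A a I₁′ I₂′)) same
  where
  same : ∀ R v → rel (pairStruct l₁ A a I₁ I₂) R v ⇔ rel (pairStruct l₁ A a I₁′ I₂′) R v
  same (inj₁ j) v = sim₁ j v
  same (inj₂ j) v = sim₂ j v

-- Teams with domain D and their representation by relations on total assignments

update-restore : (ρ : Vec A k) (x : Fin k) (c : A) → (ρ [ x ]≔ c) [ x ]≔ lookup ρ x ≡ ρ
update-restore ρ x c = trans ([]≔-idempotent ρ x) ([]≔-lookup ρ x)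

restrictionAt : Subset k → Vec A k → Fin k → Maybe A
restrictionAt D a i = if does (i ∈? D) then just (lookup a i) else nothing

infix 8 _↾_
_↾_ : Vec A k → Subset k → Assign A k
a ↾ D = tabulate (restrictionAt D a)

module _ {D : Subset k} {i : Fin k} (a : Vec A k) where

  ↾-∈ : i ∈ D → lookup (a ↾ D) i ≡ just (lookup a i)
  ↾-∈ i∈D rewrite lookup∘tabulate (restrictionAt D a) i
    with i ∈? D
  ... | yes _   = refl
  ... | no i∉D = contradiction i∈D i∉D

  ↾-∉ : i ∉ D → lookup (a ↾ D) i ≡ nothing
  ↾-∉ i∉D rewrite lookup∘tabulate (restrictionAt D a) i
    with i ∈? D
  ... | yes i∈D = contradiction i∈D i∉D
  ... | no _    = refl

↾-value : {D : Subset k} {i : Fin k} (a : Vec A k) {c : A} → i ∈ D → lookup (a ↾ D) i ≡ just c → lookup a i ≡ c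
↾-value a i∈D e = just-injective (trans (sym (↾-∈ a i∈D)) e)

↾-≡⇔agree : (D : Subset k) (a b : Vec A k) → (a ↾ D ≡ b ↾ D) ⇔ AgreeOn (_∈ D) a b
↾-≡⇔agree D a b = mk⇔
  (λ e i i∈D → ↾-value a i∈D (trans (cong (λ s → lookup s i) e) (↾-∈ b i∈D)))
  (λ ag → lookup-ext λ i → entry ag i (i ∈? D))
  where
  entry : AgreeOn (_∈ D) a b → ∀ i → Dec (i ∈ D) → lookup (a ↾ D) i ≡ lookup (b ↾ D) i
  entry ag i (yes i∈D) = trans (↾-∈ a i∈D) (trans (cong just (ag i i∈D)) (sym (↾-∈ b i∈D)))
  entry ag i (no i∉D)  = trans (↾-∉ a i∉D) (sym (↾-∉ b i∉D))

↾-update : (D : Subset k) (a : Vec A k) (x : Fin k) (c : A) →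
           (a [ x ]≔ c) ↾ (D [ x ]≔ inside) ≡ (a ↾ D) [ x ]≔ just c
↾-update D a x c = lookup-ext entry
  where
  entry : ∀ i → lookup ((a [ x ]≔ c) ↾ (D [ x ]≔ inside)) i ≡ lookup ((a ↾ D) [ x ]≔ just c) i
  entry i with i ≟ x
  ... | yes refl = begin
    lookup ((a [ i ]≔ c) ↾ (D [ i ]≔ inside)) i ≡⟨ ↾-∈ (a [ i ]≔ c) (∈-added D i) ⟩
    just (lookup (a [ i ]≔ c) i)                 ≡⟨ cong just (lookup∘update i a c) ⟩
    just c                                       ≡⟨ sym (lookup∘update i (a ↾ D) (just c)) ⟩
    lookup ((a ↾ D) [ i ]≔ just c) i             ∎
    where open ≡-Reasoning
  ... | no i≢x with i ∈? D
  ...   | yes i∈D = begin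
    lookup ((a [ x ]≔ c) ↾ (D [ x ]≔ inside)) i ≡⟨ ↾-∈ (a [ x ]≔ c) (∈-added⁺ x i∈D) ⟩
    just (lookup (a [ x ]≔ c) i)                 ≡⟨ cong just (lookup∘update′ i≢x a c) ⟩
    just (lookup a i)                            ≡⟨ sym (↾-∈ a i∈D) ⟩
    lookup (a ↾ D) i                             ≡⟨ sym (lookup∘update′ i≢x (a ↾ D) (just c)) ⟩
    lookup ((a ↾ D) [ x ]≔ just c) i             ∎
    where open ≡-Reasoning
  ...   | no i∉D = trans (↾-∉ (a [ x ]≔ c) (λ i∈ → i∉D (∈-added⁻ i≢x i∈)))
                         (sym (trans (lookup∘update′ i≢x (a ↾ D) (just c)) (↾-∉ a i∉D)))

↾-reset : (D : Subset k) (ρ : Vec A k) (x : Fin k) (c : A) →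
          ρ ↾ (D [ x ]≔ inside) ≡ ((ρ [ x ]≔ c) ↾ D) [ x ]≔ just (lookup ρ x)
↾-reset D ρ x c = trans (cong (_↾ (D [ x ]≔ inside)) (sym (update-restore ρ x c)))
                        (↾-update D (ρ [ x ]≔ c) x (lookup ρ x))

agree-reset : {D : Subset k} {x : Fin k} (ρ b : Vec A k) (c : A) →
              AgreeOn (_∈ D [ x ]≔ inside) ρ (b [ x ]≔ c) → AgreeOn (_∈ D) (ρ [ x ]≔ lookup b x) b
agree-reset {x = x} ρ b c ag i i∈D with i ≟ x
... | yes refl = lookup∘update i ρ (lookup b i)
... | no i≢x   = trans (lookup∘update′ i≢x ρ _)
                       (trans (ag i (∈-added⁺ x i∈D)) (lookup∘update′ i≢x b c))

↾-⊥ : (a : Vec A k) → a ↾ ⊥ ≡ replicate k nothing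
↾-⊥ a = lookup-ext λ i → trans (↾-∉ a ∉⊥) (sym (lookup-replicate i nothing))

↾-tuple : {D : Subset k} (a : Vec A k) (ys : Vec (Fin k) n) → (∀ i → lookup ys i ∈ D) →
          map (lookup (a ↾ D)) ys ≡ map just (map (lookup a) ys)
↾-tuple a []       ys⊆D = refl
↾-tuple a (y ∷ ys) ys⊆D = cong₂ _∷_ (↾-∈ a (ys⊆D zero)) (↾-tuple a ys (λ i → ys⊆D (suc i)))

Represents : Subset k → Team A k → (Vec A k → Set) → Set
Represents D X T = ∀ a → T a ⇔ X (a ↾ D)

canonical : (D : Subset k) (X : Team A k) → Represents D X (λ a → X (a ↾ D))
canonical D X a = ⇔-id _

rep-unique : {D : Subset k} {X : Team A k} {T T′ : Vec A k → Set} →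
             Represents D X T → Represents D X T′ → ∀ a → T a ⇔ T′ a
rep-unique rep rep′ a = ⇔-sym (rep′ a) ⇔-∘ rep a

rep-invariant : {D : Subset k} {X : Team A k} {T : Vec A k → Set} →
                Represents D X T → Invariant D T
rep-invariant {D = D} {X} rep a b ag Tb =
  from (rep a) (subst X (sym (from (↾-≡⇔agree D a b) ag)) (to (rep b) Tb))

teamOf : Subset k → (Vec A k → Set) → Team A k
teamOf D T s = ∃ λ a → s ≡ a ↾ D × T a

teamOf-rep : {D : Subset k} {T : Vec A k → Set} → Invariant D T → Represents D (teamOf D T) T
teamOf-rep {D = D} inv a = mk⇔ (λ Ta → a , refl , Ta)
                               (λ (b , e , Tb) → inv a b (to (↾-≡⇔agree D a b) e) Tb)

dup : Team A k → Fin k → Team A k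
dup X x t = ∃₂ λ s a → X s × t ≡ s [ x ]≔ just a

supp : Team A k → Fin k → (Assign A k → A → Set) → Team A k
supp X x F t = ∃₂ λ s a → X s × F s a × t ≡ s [ x ]≔ just a

Total : Team A k → (Assign A k → A → Set) → Set
Total X F = ∀ s → X s → ∃ (F s)

Proj : (Vec A k → Set) → Vec (Fin k) n → Vec A n → Set
Proj T ys t = ∃ λ b → T b × map (lookup b) ys ≡ t

-- Lemmas needing an element of the universe (to fill the values outside a domain)
module Teams {A : Set} (a₀ : A) where

  domain-↾ : {D : Subset k} {X : Team A k} → HasDomain X D → ∀ s → X s → ∃ λ a → s ≡ a ↾ D
  domain-↾ {D = D} dom s s∈X = map (fromMaybe a₀) s , lookup-ext entry
    where
    entry : ∀ i → lookup s i ≡ lookup (map (fromMaybe a₀) s ↾ D) i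
    entry i with i ∈? D | lookup s i in eq | dom s s∈X i
    ... | yes i∈D | just c  | _ =
      sym (trans (↾-∈ (map (fromMaybe a₀) s) i∈D)
                 (cong just (trans (lookup-map i (fromMaybe a₀) s) (cong (fromMaybe a₀) eq))))
    ... | yes i∈D | nothing | (defined , _) with defined i∈D
    ...   | ()
    entry i | no i∉D | just c  | (_ , inD) = contradiction (inD (isJust tt)) i∉D
    entry i | no i∉D | nothing | _ = sym (↾-∉ (map (fromMaybe a₀) s) i∉D)

  ↾-domain : {D : Subset k} {X : Team A k} → (∀ s → X s → ∃ λ a → s ≡ a ↾ D) → HasDomain X D
  ↾-domain {D = D} h s s∈X i with h s s∈X
  ... | a , refl = defined , inD
    where
    defined : i ∈ D → Is-just (lookup (a ↾ D) i)
    defined i∈D = subst Is-just (sym (↾-∈ a i∈D)) (isJust tt)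
    inD : Is-just (lookup (a ↾ D) i) → i ∈ D
    inD j with i ∈? D
    ... | yes i∈D = i∈D
    ... | no i∉D  = contradiction (subst Is-just (↾-∉ a i∉D) j) λ ()

  teamOf-domain : {D : Subset k} {T : Vec A k → Set} → HasDomain (teamOf D T) D
  teamOf-domain = ↾-domain λ s (a , s≡a↾D , _) → a , s≡a↾D

  members : {D : Subset k} {X : Team A k} → HasDomain X D → (Φ : Assign A k → Set) →
            (∀ s → X s → Φ s) ⇔ (∀ a → X (a ↾ D) → Φ (a ↾ D))
  members {X = X} dom Φ = mk⇔ (λ h a → h (a ↾ _))
    (λ h s s∈X → let (a , s≡a↾D) = domain-↾ dom s s∈X
                 in subst Φ (sym s≡a↾D) (h a (subst X s≡a↾D s∈X)))

  union-rep : {D : Subset k} {X Y Z : Team A k} {T TY TZ : Vec A k → Set} →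
              HasDomain X D → HasDomain Y D → HasDomain Z D →
              Represents D X T → Represents D Y TY → Represents D Z TZ →
              (∀ a → T a ⇔ (TY a ⊎ TZ a)) → ∀ s → X s ⇔ (Y s ⊎ Z s)
  union-rep {X = X} {Y} {Z} domX domY domZ repX repY repZ split s = mk⇔ toYZ fromYZ
    where
    toYZ : X s → Y s ⊎ Z s
    toYZ s∈X with domain-↾ domX s s∈X
    ... | a , refl with to (split a) (from (repX a) s∈X)
    ...   | inj₁ TYa = inj₁ (to (repY a) TYa)
    ...   | inj₂ TZa = inj₂ (to (repZ a) TZa)
    fromYZ : Y s ⊎ Z s → X s
    fromYZ (inj₁ s∈Y) with domain-↾ domY s s∈Y
    ... | a , refl = to (repX a) (from (split a) (inj₁ (from (repY a) s∈Y)))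
    fromYZ (inj₂ s∈Z) with domain-↾ domZ s s∈Z
    ... | a , refl = to (repX a) (from (split a) (inj₂ (from (repZ a) s∈Z)))

  dup-domain : {D : Subset k} {X X′ : Team A k} (x : Fin k) → HasDomain X D →
               (∀ t → X′ t → dup X x t) → HasDomain X′ (D [ x ]≔ inside)
  dup-domain {D = D} {X′ = X′} x dom X′⊆dup = ↾-domain extend
    where
    extend : ∀ t → X′ t → ∃ λ a → t ≡ a ↾ (D [ x ]≔ inside)
    extend t t∈X′ with X′⊆dup t t∈X′
    ... | s , c , s∈X , refl with domain-↾ dom s s∈X
    ...   | b , refl = b [ x ]≔ c , sym (↾-update D b x c)

  dup-rep : {D : Subset k} {X : Team A k} {T : Vec A k → Set} (x : Fin k) → HasDomain X D →
            Represents D X T → Represents (D [ x ]≔ inside) (dup X x) (∃ᵛ x T)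
  dup-rep {D = D} {X} {T} x dom rep ρ = mk⇔ toDup fromDup
    where
    toDup : ∃ᵛ x T ρ → dup X x (ρ ↾ (D [ x ]≔ inside))
    toDup (c , T[c]) = (ρ [ x ]≔ c) ↾ D , lookup ρ x , to (rep (ρ [ x ]≔ c)) T[c] , ↾-reset D ρ x c
    fromDup : dup X x (ρ ↾ (D [ x ]≔ inside)) → ∃ᵛ x T ρ
    fromDup (s , c , s∈X , e) with domain-↾ dom s s∈X
    ... | b , refl = lookup b x , from (rep (ρ [ x ]≔ lookup b x)) (subst X (sym same) s∈X)
      where
      same : (ρ [ x ]≔ lookup b x) ↾ D ≡ b ↾ D
      same = from (↾-≡⇔agree D (ρ [ x ]≔ lookup b x) b)
               (agree-reset ρ b c (to (↾-≡⇔agree _ ρ (b [ x ]≔ c)) (trans e (sym (↾-update D b x c)))))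

  supp-rep⇒ : {D : Subset k} {X : Team A k} {T T₁ : Vec A k → Set} {F : Assign A k → A → Set}
              (x : Fin k) → HasDomain X D → Represents D X T → Total X F →
              Represents (D [ x ]≔ inside) (supp X x F) T₁ →
              (∀ ρ → T ρ → ∃ᵛ x T₁ ρ) × (∀ ρ → T₁ ρ → ∃ᵛ x T ρ)
  supp-rep⇒ {D = D} x dom rep total rep₁ =
    (λ ρ Tρ → let (c , Fc) = total (ρ ↾ D) (to (rep ρ) Tρ)
              in c , from (rep₁ (ρ [ x ]≔ c))
                       (ρ ↾ D , c , to (rep ρ) Tρ , Fc , ↾-update D ρ x c)) ,
    (λ ρ T₁ρ → let (s , c , s∈X , _ , e) = to (rep₁ ρ) T₁ρ
               in from (dup-rep x dom rep ρ) (s , c , s∈X , e))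

  supp-rep⇐ : {D : Subset k} {X : Team A k} {T T₁ : Vec A k → Set} (x : Fin k) →
              HasDomain X D → Represents D X T → Invariant (D [ x ]≔ inside) T₁ →
              (∀ ρ → T ρ → ∃ᵛ x T₁ ρ) → (∀ ρ → T₁ ρ → ∃ᵛ x T ρ) →
              Σ (Assign A k → A → Set) λ F → Total X F × Represents (D [ x ]≔ inside) (supp X x F) T₁
  supp-rep⇐ {k = k} {D = D} {X} {T} {T₁} x dom rep inv T⊆∃T₁ T₁⊆∃T = F , total , rep₁
    where
    F : Assign A k → A → Set
    F s c = ∃ λ b → s ≡ b ↾ D × T₁ (b [ x ]≔ c)
    total : Total X F
    total s s∈X with domain-↾ dom s s∈X
    ... | b , refl = let (c , T₁c) = T⊆∃T₁ b (from (rep b) s∈X) in c , b , refl , T₁c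
    rep₁ : Represents (D [ x ]≔ inside) (supp X x F) T₁
    rep₁ ρ = mk⇔ toSupp fromSupp
      where
      toSupp : T₁ ρ → supp X x F (ρ ↾ (D [ x ]≔ inside))
      toSupp T₁ρ = let (c , Tc) = T₁⊆∃T ρ T₁ρ in
        (ρ [ x ]≔ c) ↾ D , lookup ρ x , to (rep (ρ [ x ]≔ c)) Tc ,
        (ρ [ x ]≔ c , refl , subst T₁ (sym (update-restore ρ x c)) T₁ρ) , ↾-reset D ρ x c
      fromSupp : supp X x F (ρ ↾ (D [ x ]≔ inside)) → T₁ ρ
      fromSupp (s , c , _ , (b , refl , T₁b) , e) =
        inv ρ (b [ x ]≔ c) (to (↾-≡⇔agree _ ρ (b [ x ]≔ c)) (trans e (sym (↾-update D b x c)))) T₁b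

  relT-proj : {D : Subset k} {X : Team A k} {T : Vec A k → Set} → HasDomain X D → Represents D X T →
              (ys : Vec (Fin k) n) → (∀ i → lookup ys i ∈ D) → ∀ t → relT X ys t ⇔ Proj T ys t
  relT-proj {X = X} {T} dom rep ys ys⊆D t = mk⇔ toProj fromProj
    where
    toProj : relT X ys t → Proj T ys t
    toProj (s , s∈X , e) with domain-↾ dom s s∈X
    ... | b , refl = b , from (rep b) s∈X , map-just-injective (trans (sym (↾-tuple b ys ys⊆D)) e)
    fromProj : Proj T ys t → relT X ys t
    fromProj (b , Tb , e) = b ↾ _ , to (rep b) Tb , trans (↾-tuple b ys ys⊆D) (cong (map just) e)

Consistent : Vec (Fin k) n → Vec A n → Set
Consistent ys t = ∀ p q → lookup ys p ≡ lookup ys q → lookup t p ≡ lookup t q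

values-consistent : (b : Vec A k) (ys : Vec (Fin k) n) → Consistent ys (map (lookup b) ys)
values-consistent b ys p q e = trans (lookup-map p (lookup b) ys)
                                     (trans (cong (lookup b) e) (sym (lookup-map q (lookup b) ys)))

realize : (ρ₀ : Vec A k) (ys : Vec (Fin k) n) (t : Vec A n) → Consistent ys t →
          ∃ λ ρ → map (lookup ρ) ys ≡ t
realize ρ₀ []       []      _    = ρ₀ , refl
realize ρ₀ (y ∷ ys) (c ∷ t) cons with realize ρ₀ ys t (λ p q → cons (suc p) (suc q))
... | ρ , ys[ρ]≡t = ρ [ y ]≔ c , cong₂ _∷_ (lookup∘update y ρ c) (lookup-ext entry)
  where
  entry : ∀ p → lookup (map (lookup (ρ [ y ]≔ c)) ys) p ≡ lookup t p
  entry p rewrite lookup-map p (lookup (ρ [ y ]≔ c)) ys with lookup ys p ≟ y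
  ... | yes ysp≡y rewrite ysp≡y = trans (lookup∘update y ρ c) (cons zero (suc p) (sym ysp≡y))
  ... | no ysp≢y = trans (lookup∘update′ ysp≢y ρ c)
                         (trans (sym (lookup-map p (lookup ρ) ys)) (cong (λ v → lookup v p) ys[ρ]≡t))

values≡⇔agree : (a b : Vec A k) (ys : Vec (Fin k) n) →
                (map (lookup a) ys ≡ map (lookup b) ys) ⇔ AgreeOn (_∈ᵥ ys) a b
values≡⇔agree a b ys = mk⇔ (λ e v v∈ys → agree ys e v∈ys)
  (λ ag → lookup-ext λ p → trans (lookup-map p (lookup a) ys)
            (trans (ag _ (∈-lookup p ys)) (sym (lookup-map p (lookup b) ys))))
  where
  agree : ∀ {n} (ys : Vec (Fin _) n) {v} → map (lookup a) ys ≡ map (lookup b) ys → v ∈ᵥ ys →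
          lookup a v ≡ lookup b v
  agree (y ∷ ys) e (here refl) = cong head e
  agree (y ∷ ys) e (there v∈) = agree ys (cong tail e) v∈

-- Defining the projection of a relation in FOC^k
--
-- With Tᶠ defining a k-ary relation T and Sᶠ w an n-ary atom S applied to
-- the variables w, the projection axiom forces S = Proj T ys using only the
-- k variables: S(ys) follows from T, S(ys) implies that T holds after
-- changing the variables outside ys, and S only contains tuples consistent
-- with the pattern of repetitions in ys (read off through a tuple W of
-- distinct variables).

module _ {σ : Vocab} {k : ℕ} where

  samePosition : Fin k → (Vec (Fin k) n → FOC σ k) → (ys W : Vec (Fin k) n) → Fin n → Fin n → FOC σ k
  samePosition z Sᶠ ys W p q =
    if does (lookup ys p ≟ lookup ys q) then (Sᶠ W ⇒ᶠ eqᶠ (lookup W p) (lookup W q)) else ⊤ᶠ z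

  projection-axiom : Fin k → FOC σ k → (Vec (Fin k) n → FOC σ k) → (ys W : Vec (Fin k) n) → FOC σ k
  projection-axiom {n = n} z Tᶠ Sᶠ ys W =
    andᶠ (Tᶠ ⇒ᶠ Sᶠ ys)
   (andᶠ (Sᶠ ys ⇒ᶠ ∃⃗ (outsideOf (λ v → any? (v ≟_) ys)) Tᶠ)
         (⋀ z n λ p → ⋀ z n λ q → samePosition z Sᶠ ys W p q))

module ProjectionSemantics (em : ExcludedMiddle 0ℓ) (𝔅 : Struct σ) where
  open FOCSemantics em 𝔅

  module _ (z : Fin k) (Tᶠ : FOC σ k) {T : Vec (U 𝔅) k → Set} (Tᶠ-def : Defines Tᶠ T)
           (Sᶠ : Vec (Fin k) n → FOC σ k) {S : Vec (U 𝔅) n → Set}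
           (Sᶠ-def : ∀ w ρ → satF 𝔅 (Sᶠ w) ρ ⇔ S (map (lookup ρ) w))
           (ys W : Vec (Fin k) n) (W-distinct : ∀ p q → lookup W p ≡ lookup W q → p ≡ q) where

    samePosition-valid : (∀ p q → Valid (samePosition z Sᶠ ys W p q)) ⇔ (∀ t → S t → Consistent ys t)
    samePosition-valid = mk⇔ consistent valid
      where
      consistent : (∀ p q → Valid (samePosition z Sᶠ ys W p q)) → ∀ t → S t → Consistent ys t
      consistent v t St p q ysp≡ysq with lookup ys p ≟ lookup ys q | v p q
      ... | no ysp≢ysq | _ = contradiction ysp≡ysq ysp≢ysq
      ... | yes _      | Wp≡Wq
          with realize (replicate k (elem 𝔅)) W t (λ p q e → cong (lookup t) (W-distinct p q e))
      ...   | ρ , W[ρ]≡t = begin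
        lookup t p                   ≡⟨ cong (λ u → lookup u p) (sym W[ρ]≡t) ⟩
        lookup (map (lookup ρ) W) p  ≡⟨ lookup-map p (lookup ρ) W ⟩
        lookup ρ (lookup W p)        ≡⟨ Wp≡Wq-at-ρ ⟩
        lookup ρ (lookup W q)        ≡⟨ sym (lookup-map q (lookup ρ) W) ⟩
        lookup (map (lookup ρ) W) q  ≡⟨ cong (λ u → lookup u q) W[ρ]≡t ⟩
        lookup t q                   ∎
        where
        open ≡-Reasoning
        Wp≡Wq-at-ρ : lookup ρ (lookup W p) ≡ lookup ρ (lookup W q)
        Wp≡Wq-at-ρ = to (⇒ᶠ-sem (Sᶠ W) (eqᶠ (lookup W p) (lookup W q)) ρ) (Wp≡Wq ρ)
                        (from (Sᶠ-def W ρ) (subst S (sym W[ρ]≡t) St))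
      valid : (∀ t → S t → Consistent ys t) → ∀ p q → Valid (samePosition z Sᶠ ys W p q)
      valid cons p q ρ with lookup ys p ≟ lookup ys q
      ... | no _        = refl
      ... | yes ysp≡ysq = from (⇒ᶠ-sem (Sᶠ W) (eqᶠ (lookup W p) (lookup W q)) ρ) λ SW →
        let c = cons _ (to (Sᶠ-def W ρ) SW) p q ysp≡ysq
        in trans (sym (lookup-map p (lookup ρ) W)) (trans c (lookup-map q (lookup ρ) W))

    projection-valid : Valid (projection-axiom z Tᶠ Sᶠ ys W) ⇔ (∀ t → S t ⇔ Proj T ys t)
    projection-valid = mk⇔ characterise axioms
      where
      ys? : Decidable (_∈ᵥ ys)
      ys? v = any? (v ≟_) ys
      middle : ∀ ρ → satF 𝔅 (Sᶠ ys ⇒ᶠ ∃⃗ (outsideOf ys?) Tᶠ) ρ ⇔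
                     (S (map (lookup ρ) ys) → ∃ λ ρ′ → AgreeOn (_∈ᵥ ys) ρ′ ρ × T ρ′)
      middle ρ = →-cong-⇔ (Sᶠ-def ys ρ)
                   (∃-cong-⇔ (λ ρ′ → ⇔-id _ ×-⇔ Tᶠ-def ρ′) ⇔-∘ ∃-outside-sem ys? Tᶠ ρ)
                 ⇔-∘ ⇒ᶠ-sem (Sᶠ ys) (∃⃗ (outsideOf ys?) Tᶠ) ρ
      consistency : Valid (⋀ z n λ p → ⋀ z n λ q → samePosition z Sᶠ ys W p q) ⇔
                    (∀ t → S t → Consistent ys t)
      consistency = samePosition-valid ⇔-∘ (∀-cong-⇔ (λ p → ⋀-valid z n _) ⇔-∘ ⋀-valid z n _)
      characterise : Valid (projection-axiom z Tᶠ Sᶠ ys W) → ∀ t → S t ⇔ Proj T ys t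
      characterise v t = mk⇔ toProj fromProj
        where
        toProj : S t → Proj T ys t
        toProj St with realize (replicate k (elem 𝔅)) ys t (to consistency (λ ρ → proj₂ (proj₂ (v ρ))) t St)
        ... | ρ , ys[ρ]≡t with to (middle ρ) (proj₁ (proj₂ (v ρ))) (subst S (sym ys[ρ]≡t) St)
        ...   | ρ′ , ag , Tρ′ = ρ′ , Tρ′ , trans (from (values≡⇔agree ρ′ ρ ys) ag) ys[ρ]≡t
        fromProj : Proj T ys t → S t
        fromProj (b , Tb , ys[b]≡t) =
          subst S ys[b]≡t (to (Sᶠ-def ys b) (to (⇒ᶠ-sem Tᶠ (Sᶠ ys) b) (proj₁ (v b)) (from (Tᶠ-def b) Tb)))
      axioms : (∀ t → S t ⇔ Proj T ys t) → Valid (projection-axiom z Tᶠ Sᶠ ys W)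
      axioms S⇔Proj ρ =
        from (⇒ᶠ-sem Tᶠ (Sᶠ ys) ρ) (λ Tρ → from (Sᶠ-def ys ρ) (from (S⇔Proj _) (ρ , to (Tᶠ-def ρ) Tρ , refl))) ,
        from (middle ρ) (λ S[ρ] → let (b , Tb , e) = to (S⇔Proj _) S[ρ] in
                                  b , to (values≡⇔agree b ρ ys) e , Tb) ,
        from consistency (λ t St → let (b , _ , e) = to (S⇔Proj t) St in
                                   subst (Consistent ys) e (values-consistent b ys)) ρ

-- The translation of FO^k(A_Q) into Σ¹₁(FOC^k)
--
-- Relative to a domain D, a formula φ becomes an FOC^k formula tr D φ over
-- τ expanded by a k-ary team symbol 𝕋 (standing for a team with domain D,
-- through its representation) and auxiliary symbols of arities aux φ.

module Translation {k : ℕ} (z : Fin k) {τ : Vocab} {G : GQ} (Def : Definable k G) where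

  tG : List ℕ
  tG = type G

  φQ : ESO (listVoc tG) k
  φQ = proj₁ (proj₂ Def)

  aQ : List ℕ
  aQ = arities φQ

  𝕋₀ : FOC (τ ⊕ᴸ (k ∷ l)) k
  𝕋₀ = relᶠ (inj₂ zero) (allFin k)

  𝕋₁ : FOC (τ ⊕ᴸ (k ∷ k ∷ l)) k
  𝕋₁ = relᶠ (inj₂ (suc zero)) (allFin k)

  𝕋₂ : FOC (τ ⊕ᴸ (k ∷ k ∷ k ∷ l)) k
  𝕋₂ = relᶠ (inj₂ (suc (suc zero))) (allFin k)

  -- arities of the auxiliary symbols: two teams for ∨, one team for ∃ and ∀,
  -- and for A_Q the relations rel(X, x̄_j) together with the second-order
  -- variables of the defining sentence of A_Q
  aux : FOQ τ k G → List ℕ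
  aux (relᵗ R xs)  = []
  aux (nrelᵗ R xs) = []
  aux (eqᵗ x y)    = []
  aux (neqᵗ x y)   = []
  aux (andᵗ φ ψ)   = aux φ ++ aux ψ
  aux (orᵗ φ ψ)    = k ∷ k ∷ (aux φ ++ aux ψ)
  aux (exᵗ x φ)    = k ∷ aux φ
  aux (faᵗ x φ)    = k ∷ aux φ
  aux (gatomᵗ xs)  = tG ++ aQ

  ↪-andˡ : (φ ψ : FOQ τ k G) → k ∷ aux φ ↪ k ∷ (aux φ ++ aux ψ)
  ↪-andˡ φ ψ = ↪-keep (↪-inl (aux φ))

  ↪-andʳ : (φ ψ : FOQ τ k G) → k ∷ aux ψ ↪ k ∷ (aux φ ++ aux ψ)
  ↪-andʳ φ ψ = ↪-keep (↪-inr (aux φ))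

  ↪-orˡ : (φ ψ : FOQ τ k G) → k ∷ aux φ ↪ k ∷ k ∷ k ∷ (aux φ ++ aux ψ)
  ↪-orˡ φ ψ = ↪-there (↪-keep (↪-there (↪-inl (aux φ))))

  ↪-orʳ : (φ ψ : FOQ τ k G) → k ∷ aux ψ ↪ k ∷ k ∷ k ∷ (aux φ ++ aux ψ)
  ↪-orʳ φ ψ = ↪-there (↪-there (↪-keep (↪-inr (aux φ))))

  ↪-quant : k ∷ l ↪ k ∷ k ∷ l
  ↪-quant = ↪-there ↪-id

  ↪-S : tG ↪ k ∷ (tG ++ aQ)
  ↪-S = ↪-there (↪-inl tG)

  ↪-Q : aQ ↪ k ∷ (tG ++ aQ)
  ↪-Q = ↪-there (↪-inr tG)

  -- distinct variables x_1 … x_{i_j} (i_j ≤ k by definability)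
  W : (j : Fin (length tG)) → Vec (Fin k) (L.lookup tG j)
  W j = tabulate λ p → inject≤ p (proj₁ Def j)

  W-distinct : ∀ j p q → lookup (W j) p ≡ lookup (W j) q → p ≡ q
  W-distinct j p q e = inject≤-injective (proj₁ Def j) (proj₁ Def j) p q
    (trans (sym (lookup∘tabulate _ p)) (trans e (lookup∘tabulate _ q)))

  splitAxiom : Subset k → FOC (τ ⊕ᴸ (k ∷ k ∷ k ∷ l)) k
  splitAxiom D = andᶠ (𝕋₀ ⇔ᶠ orᶠ 𝕋₁ 𝕋₂) (andᶠ (cylinder D 𝕋₁) (cylinder D 𝕋₂))

  supplementAxiom : Subset k → Fin k → FOC (τ ⊕ᴸ (k ∷ k ∷ l)) k
  supplementAxiom D x =
    andᶠ (𝕋₀ ⇒ᶠ exᶠ x 𝕋₁) (andᶠ (𝕋₁ ⇒ᶠ exᶠ x 𝕋₀) (cylinder (D [ x ]≔ inside) 𝕋₁))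

  duplicateAxiom : Fin k → FOC (τ ⊕ᴸ (k ∷ k ∷ l)) k
  duplicateAxiom x = 𝕋₁ ⇔ᶠ exᶠ x 𝕋₀

  projectionAxioms : ((j : Fin (length tG)) → Vec (Fin k) (L.lookup tG j)) → FOC (τ ⊕ᴸ (k ∷ (tG ++ aQ))) k
  projectionAxioms xs = ⋀ z (length tG) λ j → projection-axiom z 𝕋₀ (atomVia ↪-S j) (xs j) (W j)

  tr : Subset k → (φ : FOQ τ k G) → FOC (τ ⊕ᴸ (k ∷ aux φ)) k
  tr D (relᵗ R xs)  = 𝕋₀ ⇒ᶠ relᶠ (inj₁ R) xs
  tr D (nrelᵗ R xs) = 𝕋₀ ⇒ᶠ negᶠ (relᶠ (inj₁ R) xs)
  tr D (eqᵗ x y)    = 𝕋₀ ⇒ᶠ eqᶠ x y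
  tr D (neqᵗ x y)   = 𝕋₀ ⇒ᶠ negᶠ (eqᶠ x y)
  tr D (andᵗ φ ψ)   = andᶠ (embed (↪-andˡ φ ψ) (tr D φ)) (embed (↪-andʳ φ ψ) (tr D ψ))
  tr D (orᵗ φ ψ)    = andᶠ (splitAxiom D) (andᶠ (embed (↪-orˡ φ ψ) (tr D φ)) (embed (↪-orʳ φ ψ) (tr D ψ)))
  tr D (exᵗ x φ)    = andᶠ (supplementAxiom D x) (embed ↪-quant (tr (D [ x ]≔ inside) φ))
  tr D (faᵗ x φ)    = andᶠ (duplicateAxiom x) (embed ↪-quant (tr (D [ x ]≔ inside) φ))
  tr D (gatomᵗ xs)  = andᶠ (rename-pair ↪-S ↪-Q (body φQ)) (projectionAxioms xs)

  sentence : FOQ τ k G → ESO τ k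
  sentence φ = record
    { arities = k ∷ aux φ
    ; body    = closure (andᶠ 𝕋₀ (tr ⊥ φ))
    ; closed  = closure-closed (andᶠ 𝕋₀ (tr ⊥ φ))
    }

  module AxiomValidity (em : ExcludedMiddle 0ℓ) (𝔄 : Struct τ) where

    infix 4 _⊨ᴵ_
    _⊨ᴵ_ : Interp (U 𝔄) l → FOC (τ ⊕ᴸ l) k → Set
    I ⊨ᴵ φ = ∀ ρ → satF (expandᴵ 𝔄 I) φ ρ

    module _ (I : Interp (U 𝔄) (k ∷ l)) where
      open FOCSemantics em (expandᴵ 𝔄 I)

      𝕋₀-def : Defines 𝕋₀ (rels I zero)
      𝕋₀-def = allFin-atom (rels I zero)

      literal-valid : (ψ : FOC (τ ⊕ᴸ (k ∷ l)) k) →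
                      I ⊨ᴵ (𝕋₀ ⇒ᶠ ψ) ⇔ (∀ ρ → rels I zero ρ → satF (expandᴵ 𝔄 I) ψ ρ)
      literal-valid ψ = ⇒-valid 𝕋₀ ψ 𝕋₀-def (λ ρ → ⇔-id _)

    module _ (I : Interp (U 𝔄) (k ∷ k ∷ l)) where
      open FOCSemantics em (expandᴵ 𝔄 I)

      private
        T T₁ : Vec (U 𝔄) k → Set
        T  = rels I zero
        T₁ = rels I (suc zero)
        𝕋₁-def : Defines 𝕋₁ T₁
        𝕋₁-def = allFin-atom T₁

      supplement-valid : (D : Subset k) (x : Fin k) → I ⊨ᴵ supplementAxiom D x ⇔
                         ((∀ ρ → T ρ → ∃ᵛ x T₁ ρ) × (∀ ρ → T₁ ρ → ∃ᵛ x T ρ) × Invariant (D [ x ]≔ inside) T₁)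
      supplement-valid D x =
        (⇒-valid 𝕋₀ (exᶠ x 𝕋₁) (𝕋₀-def I) (∃-defines x 𝕋₁ 𝕋₁-def) ×-⇔
         (⇒-valid 𝕋₁ (exᶠ x 𝕋₀) 𝕋₁-def (∃-defines x 𝕋₀ (𝕋₀-def I)) ×-⇔ cylinder-valid _ 𝕋₁ 𝕋₁-def))
        ⇔-∘ ∧₃-valid (𝕋₀ ⇒ᶠ exᶠ x 𝕋₁) (𝕋₁ ⇒ᶠ exᶠ x 𝕋₀) (cylinder (D [ x ]≔ inside) 𝕋₁)

      duplicate-valid : (x : Fin k) → I ⊨ᴵ duplicateAxiom x ⇔ (∀ ρ → T₁ ρ ⇔ ∃ᵛ x T ρ)
      duplicate-valid x = ⇔-valid 𝕋₁ (exᶠ x 𝕋₀) 𝕋₁-def (∃-defines x 𝕋₀ (𝕋₀-def I))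

    module _ (I : Interp (U 𝔄) (k ∷ k ∷ k ∷ l)) where
      open FOCSemantics em (expandᴵ 𝔄 I)

      private
        T T₁ T₂ : Vec (U 𝔄) k → Set
        T  = rels I zero
        T₁ = rels I (suc zero)
        T₂ = rels I (suc (suc zero))

      split-valid : (D : Subset k) → I ⊨ᴵ splitAxiom D ⇔
                    ((∀ a → T a ⇔ (T₁ a ⊎ T₂ a)) × Invariant D T₁ × Invariant D T₂)
      split-valid D =
        (⇔-valid 𝕋₀ (orᶠ 𝕋₁ 𝕋₂) (𝕋₀-def I) (∨-defines 𝕋₁ 𝕋₂ (allFin-atom T₁) (allFin-atom T₂)) ×-⇔
         (cylinder-valid D 𝕋₁ (allFin-atom T₁) ×-⇔ cylinder-valid D 𝕋₂ (allFin-atom T₂)))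
        ⇔-∘ ∧₃-valid (𝕋₀ ⇔ᶠ orᶠ 𝕋₁ 𝕋₂) (cylinder D 𝕋₁) (cylinder D 𝕋₂)

    projections-valid : (xs : (j : Fin (length tG)) → Vec (Fin k) (L.lookup tG j))
                        (I : Interp (U 𝔄) (k ∷ (tG ++ aQ))) → I ⊨ᴵ projectionAxioms xs ⇔
                        (∀ j t → rels (restrict ↪-S I) j t ⇔ Proj (rels I zero) (xs j) t)
    projections-valid xs I =
      ∀-cong-⇔ (λ j → projection-valid z 𝕋₀ (𝕋₀-def I) (atomVia ↪-S j) (atomVia-sem ↪-S 𝔄 I j)
                                       (xs j) (W j) (W-distinct j))
      ⇔-∘ ⋀-valid z (length tG) _
      where
      open FOCSemantics em (expandᴵ 𝔄 I)
      open ProjectionSemantics em (expandᴵ 𝔄 I)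

  module Correctness (em : ExcludedMiddle 0ℓ) (𝔄 : Struct τ) where
    open AxiomValidity em 𝔄
    open Teams (elem 𝔄)

    Witness : Subset k → (φ : FOQ τ k G) → Team (U 𝔄) k → Set₁
    Witness D φ X = Σ (Interp (U 𝔄) (k ∷ aux φ)) λ I → Represents D X (rels I zero) × I ⊨ᴵ tr D φ

    Correct : Subset k → FOQ τ k G → Set₁
    Correct D φ = ∀ X → HasDomain X D → satT 𝔄 φ X ⇔ Witness D φ X

    literal-case : {D : Subset k} {X : Team (U 𝔄) k} → HasDomain X D →
                   (Φ : Assign (U 𝔄) k → Set) (ψ : FOC (τ ⊕ᴸ (k ∷ [])) k) →
                   (∀ I a → Φ (a ↾ D) ⇔ satF (expandᴵ 𝔄 I) ψ a) →
                   (∀ s → X s → Lift (Level.suc 0ℓ) (Φ s)) ⇔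
                   Σ (Interp (U 𝔄) (k ∷ [])) λ I → Represents D X (rels I zero) × I ⊨ᴵ (𝕋₀ ⇒ᶠ ψ)
    literal-case {D} {X} dom Φ ψ meaning = mk⇔ toW fromW
      where
      LiteralWitness : Set₁
      LiteralWitness = Σ (Interp (U 𝔄) (k ∷ [])) λ I → Represents D X (rels I zero) × I ⊨ᴵ (𝕋₀ ⇒ᶠ ψ)
      fromW : LiteralWitness → ∀ s → X s → Lift (Level.suc 0ℓ) (Φ s)
      fromW (I , rep , v) s s∈X =
        lift (from (members dom Φ)
                   (λ a Xa → from (meaning I a) (to (literal-valid I ψ) v a (from (rep a) Xa))) s s∈X)
      toW : (∀ s → X s → Lift (Level.suc 0ℓ) (Φ s)) → LiteralWitness
      toW h = I , canonical D X , from (literal-valid I ψ) λ a Xa → to (meaning I a) (lower (h (a ↾ D) Xa))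
        where
        I : Interp (U 𝔄) (k ∷ [])
        I = (λ a → X (a ↾ D)) ◂ interp λ ()

    relation-meaning : {D : Subset k} (P : Vec (U 𝔄) n → Set) (xs : Vec (Fin k) n) →
                       (∀ i → lookup xs i ∈ D) → (a : Vec (U 𝔄) k) →
                       (∃ λ t → map (lookup (a ↾ D)) xs ≡ map just t × P t) ⇔ P (map (lookup a) xs)
    relation-meaning P xs xs⊆D a = mk⇔
      (λ (t , e , Pt) → subst P (sym (map-just-injective (trans (sym (↾-tuple a xs xs⊆D)) e))) Pt)
      (λ P[a] → map (lookup a) xs , ↾-tuple a xs xs⊆D , P[a])

    equality-meaning : {D : Subset k} {x y : Fin k} → x ∈ D → y ∈ D → (a : Vec (U 𝔄) k) →
                       (∃ λ c → lookup (a ↾ D) x ≡ just c × lookup (a ↾ D) y ≡ just c) ⇔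
                       (lookup a x ≡ lookup a y)
    equality-meaning {x = x} x∈D y∈D a = mk⇔
      (λ (c , ex , ey) → trans (↾-value a x∈D ex) (sym (↾-value a y∈D ey)))
      (λ e → lookup a x , ↾-∈ a x∈D , trans (↾-∈ a y∈D) (cong just (sym e)))

    inequality-meaning : {D : Subset k} {x y : Fin k} → x ∈ D → y ∈ D → (a : Vec (U 𝔄) k) →
                         (∃₂ λ c d → lookup (a ↾ D) x ≡ just c × lookup (a ↾ D) y ≡ just d × c ≢ d) ⇔
                         (¬ lookup a x ≡ lookup a y)
    inequality-meaning {x = x} {y} x∈D y∈D a = mk⇔
      (λ (c , d , ex , ey , c≢d) e → c≢d (trans (sym (↾-value a x∈D ex)) (trans e (↾-value a y∈D ey))))
      (λ ne → lookup a x , lookup a y , ↾-∈ a x∈D , ↾-∈ a y∈D , ne)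

    and-witness : {D : Subset k} {X : Team (U 𝔄) k} (φ ψ : FOQ τ k G) →
                  Witness D φ X → Witness D ψ X → Witness D (andᵗ φ ψ) X
    and-witness {D} {X} φ ψ (Iφ , repφ , vφ) (Iψ , repψ , vψ) = I , canonical D X , λ ρ → validφ ρ , validψ ρ
      where
      I : Interp (U 𝔄) (k ∷ aux (andᵗ φ ψ))
      I = (λ a → X (a ↾ D)) ◂ join (aux φ) (tailᴵ Iφ) (tailᴵ Iψ)
      validφ : I ⊨ᴵ embed (↪-andˡ φ ψ) (tr D φ)
      validφ = embed-valid (↪-andˡ φ ψ) 𝔄 I Iφ
        (restrict-keep _ (λ a → ⇔-sym (repφ a)) (restrict-inl-join (aux φ) (tailᴵ Iφ) (tailᴵ Iψ))) (tr D φ) vφ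
      validψ : I ⊨ᴵ embed (↪-andʳ φ ψ) (tr D ψ)
      validψ = embed-valid (↪-andʳ φ ψ) 𝔄 I Iψ
        (restrict-keep _ (λ a → ⇔-sym (repψ a)) (restrict-inr-join (aux φ) (tailᴵ Iφ) (tailᴵ Iψ))) (tr D ψ) vψ

    and-case : {D : Subset k} (φ ψ : FOQ τ k G) → Correct D φ → Correct D ψ → Correct D (andᵗ φ ψ)
    and-case {D} φ ψ ihφ ihψ X dom = mk⇔
      (λ (sφ , sψ) → and-witness {X = X} φ ψ (to (ihφ X dom) sφ) (to (ihψ X dom) sψ))
      (λ (I , rep , v) →
        from (ihφ X dom) (restrict (↪-andˡ φ ψ) I , rep ,
                          embed-valid⁻ (↪-andˡ φ ψ) 𝔄 I (tr D φ) (λ ρ → proj₁ (v ρ))) ,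
        from (ihψ X dom) (restrict (↪-andʳ φ ψ) I , rep ,
                          embed-valid⁻ (↪-andʳ φ ψ) 𝔄 I (tr D ψ) (λ ρ → proj₂ (v ρ))))

    or-witness : {D : Subset k} {X Y Z : Team (U 𝔄) k} (φ ψ : FOQ τ k G) →
                 (∀ s → X s ⇔ (Y s ⊎ Z s)) → Witness D φ Y → Witness D ψ Z → Witness D (orᵗ φ ψ) X
    or-witness {D} {X} {Y} {Z} φ ψ split (Iφ , repY , vφ) (Iψ , repZ , vψ) =
      I , canonical D X , λ ρ → axioms ρ , validφ ρ , validψ ρ
      where
      I : Interp (U 𝔄) (k ∷ aux (orᵗ φ ψ))
      I = (λ a → X (a ↾ D)) ◂ (λ a → Y (a ↾ D)) ◂ (λ a → Z (a ↾ D)) ◂ join (aux φ) (tailᴵ Iφ) (tailᴵ Iψ)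
      axioms : I ⊨ᴵ splitAxiom D
      axioms = from (split-valid I D)
        ((λ a → split (a ↾ D)) , rep-invariant {X = Y} (canonical D Y) , rep-invariant {X = Z} (canonical D Z))
      validφ : I ⊨ᴵ embed (↪-orˡ φ ψ) (tr D φ)
      validφ = embed-valid (↪-orˡ φ ψ) 𝔄 I Iφ
        (restrict-keep _ (λ a → ⇔-sym (repY a)) (restrict-inl-join (aux φ) (tailᴵ Iφ) (tailᴵ Iψ))) (tr D φ) vφ
      validψ : I ⊨ᴵ embed (↪-orʳ φ ψ) (tr D ψ)
      validψ = embed-valid (↪-orʳ φ ψ) 𝔄 I Iψ
        (restrict-keep _ (λ a → ⇔-sym (repZ a)) (restrict-inr-join (aux φ) (tailᴵ Iφ) (tailᴵ Iψ))) (tr D ψ) vψ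

    -- conversely to or-witness, the split axioms make 𝕋₁, 𝕋₂ represent teams Y, Z with X = Y ∪ Z
    or-case : {D : Subset k} (φ ψ : FOQ τ k G) → Correct D φ → Correct D ψ → Correct D (orᵗ φ ψ)
    or-case {D} φ ψ ihφ ihψ X dom = mk⇔ toW fromW
      where
      toW : satT 𝔄 (orᵗ φ ψ) X → Witness D (orᵗ φ ψ) X
      toW (Y , Z , split , sY , sZ) =
        or-witness {X = X} {Y} {Z} φ ψ (λ s → mk⇔ (proj₁ (split s)) (proj₂ (split s)))
        (to (ihφ Y λ s s∈Y → dom s (proj₂ (split s) (inj₁ s∈Y))) sY)
        (to (ihψ Z λ s s∈Z → dom s (proj₂ (split s) (inj₂ s∈Z))) sZ)
      fromW : Witness D (orᵗ φ ψ) X → satT 𝔄 (orᵗ φ ψ) X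
      fromW (I , rep , v) with to (split-valid I D) (λ ρ → proj₁ (v ρ))
      ... | T≡T₁∪T₂ , invY , invZ = Y , Z , (λ s → to (X≡Y∪Z s) , from (X≡Y∪Z s)) ,
        from (ihφ Y teamOf-domain) (restrict (↪-orˡ φ ψ) I , teamOf-rep invY ,
                                    embed-valid⁻ (↪-orˡ φ ψ) 𝔄 I (tr D φ) (λ ρ → proj₁ (proj₂ (v ρ)))) ,
        from (ihψ Z teamOf-domain) (restrict (↪-orʳ φ ψ) I , teamOf-rep invZ ,
                                    embed-valid⁻ (↪-orʳ φ ψ) 𝔄 I (tr D ψ) (λ ρ → proj₂ (proj₂ (v ρ))))
        where
        Y Z : Team (U 𝔄) k
        Y = teamOf D (rels I (suc zero))
        Z = teamOf D (rels I (suc (suc zero)))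
        X≡Y∪Z : ∀ s → X s ⇔ (Y s ⊎ Z s)
        X≡Y∪Z = union-rep dom teamOf-domain teamOf-domain rep (teamOf-rep invY) (teamOf-rep invZ) T≡T₁∪T₂

    -- X ⊨ ∃x φ iff a supplement of X satisfies φ; its representation 𝕋₁ is characterised by
    -- the supplement axioms (supp-rep⇒, supp-rep⇐)
    ex-case : {D : Subset k} (x : Fin k) (φ : FOQ τ k G) → Correct (D [ x ]≔ inside) φ → Correct D (exᵗ x φ)
    ex-case {D} x φ ih X dom = mk⇔ toW fromW
      where
      domain : (F : Assign (U 𝔄) k → U 𝔄 → Set) → HasDomain (supp X x F) (D [ x ]≔ inside)
      domain F = dup-domain x dom λ t (s , c , s∈X , _ , e) → s , c , s∈X , e
      toW : satT 𝔄 (exᵗ x φ) X → Witness D (exᵗ x φ) X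
      toW (F , total , sat) with to (ih (supp X x F) (domain F)) sat
      ... | I₁ , rep₁ , v₁ = I , canonical D X , λ ρ → axioms ρ , valid ρ
        where
        I : Interp (U 𝔄) (k ∷ aux (exᵗ x φ))
        I = (λ a → X (a ↾ D)) ◂ I₁
        axioms : I ⊨ᴵ supplementAxiom D x
        axioms = from (supplement-valid I D x)
          (let (T⊆∃T₁ , T₁⊆∃T) = supp-rep⇒ {X = X} x dom (canonical D X) total rep₁
           in T⊆∃T₁ , T₁⊆∃T , rep-invariant {X = supp X x F} rep₁)
        valid : I ⊨ᴵ embed ↪-quant (tr (D [ x ]≔ inside) φ)
        valid = embed-valid ↪-quant 𝔄 I I₁ (λ _ _ → ⇔-id _) (tr (D [ x ]≔ inside) φ) v₁
      fromW : Witness D (exᵗ x φ) X → satT 𝔄 (exᵗ x φ) X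
      fromW (I , rep , v) with to (supplement-valid I D x) (λ ρ → proj₁ (v ρ))
      ... | T⊆∃T₁ , T₁⊆∃T , inv₁ with supp-rep⇐ x dom rep inv₁ T⊆∃T₁ T₁⊆∃T
      ...   | F , total , rep₁ = F , total ,
        from (ih (supp X x F) (domain F))
          (restrict ↪-quant I , rep₁ , embed-valid⁻ ↪-quant 𝔄 I (tr (D [ x ]≔ inside) φ) (λ ρ → proj₂ (v ρ)))

    -- X ⊨ ∀x φ iff the duplicate of X satisfies φ; it is represented by ∃ᵛ x 𝕋 (dup-rep)
    fa-case : {D : Subset k} (x : Fin k) (φ : FOQ τ k G) → Correct (D [ x ]≔ inside) φ → Correct D (faᵗ x φ)
    fa-case {D} x φ ih X dom = mk⇔ toW fromW
      where
      domain : HasDomain (dup X x) (D [ x ]≔ inside)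
      domain = dup-domain x dom λ t t∈dup → t∈dup
      toW : satT 𝔄 (faᵗ x φ) X → Witness D (faᵗ x φ) X
      toW sat with to (ih (dup X x) domain) sat
      ... | I₁ , rep₁ , v₁ = I , canonical D X , λ ρ → axiom ρ , valid ρ
        where
        I : Interp (U 𝔄) (k ∷ aux (faᵗ x φ))
        I = (λ a → X (a ↾ D)) ◂ I₁
        axiom : I ⊨ᴵ duplicateAxiom x
        axiom = from (duplicate-valid I x) (rep-unique {X = dup X x} rep₁ (dup-rep x dom (canonical D X)))
        valid : I ⊨ᴵ embed ↪-quant (tr (D [ x ]≔ inside) φ)
        valid = embed-valid ↪-quant 𝔄 I I₁ (λ _ _ → ⇔-id _) (tr (D [ x ]≔ inside) φ) v₁
      fromW : Witness D (faᵗ x φ) X → satT 𝔄 (faᵗ x φ) X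
      fromW (I , rep , v) = from (ih (dup X x) domain)
        (restrict ↪-quant I , rep₁ , embed-valid⁻ ↪-quant 𝔄 I (tr (D [ x ]≔ inside) φ) (λ ρ → proj₂ (v ρ)))
        where
        rep₁ : Represents (D [ x ]≔ inside) (dup X x) (rels I (suc zero))
        rep₁ ρ = dup-rep x dom rep ρ ⇔-∘ to (duplicate-valid I x) (λ ρ → proj₁ (v ρ)) ρ

    -- A_Q holds iff the relations rel(X, x̄_j) satisfy A_Q's defining sentence; the projection
    -- axioms force S_j = Proj 𝕋 x̄_j = rel(X, x̄_j) (relT-proj)
    gatom-case : {D : Subset k} (xs : (j : Fin (length tG)) → Vec (Fin k) (L.lookup tG j)) →
                 (∀ j i → lookup (xs j) i ∈ D) → Correct D (gatomᵗ xs)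
    gatom-case {D} xs xs⊆D X dom = mk⇔ toW fromW
      where
      R : Interp (U 𝔄) tG
      R = interp λ j → relT X (xs j)
      definition : (Q G (U 𝔄) (rels R) → tupleStruct tG (U 𝔄) (elem 𝔄) (rels R) ⊨ESO φQ) ×
                   (tupleStruct tG (U 𝔄) (elem 𝔄) (rels R) ⊨ESO φQ → Q G (U 𝔄) (rels R))
      definition = proj₂ (proj₂ Def) (U 𝔄) (elem 𝔄) k X D dom xs xs⊆D
      toW : satT {G = G} 𝔄 (gatomᵗ xs) X → Witness D (gatomᵗ xs) X
      toW (lift q) with proj₁ definition q
      ... | IQ , vQ = I , canonical D X , λ ρ → valid ρ , projections ρ
        where
        I : Interp (U 𝔄) (k ∷ aux (gatomᵗ xs))
        I = (λ a → X (a ↾ D)) ◂ join tG R (interp IQ)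
        valid : I ⊨ᴵ rename-pair ↪-S ↪-Q (body φQ)
        valid ρ = from (rename-pair-sem ↪-S ↪-Q 𝔄 I (body φQ) ρ)
          (from (pairStruct-cong tG (elem 𝔄) {restrict ↪-S I} {R} {restrict ↪-Q I} {interp IQ}
                   (restrict-inl-join tG R (interp IQ)) (restrict-inr-join tG R (interp IQ)) (body φQ) ρ)
                (vQ ρ))
        projections : I ⊨ᴵ projectionAxioms xs
        projections = from (projections-valid xs I) λ j t →
          relT-proj dom (canonical D X) (xs j) (xs⊆D j) t ⇔-∘ restrict-inl-join tG R (interp IQ) j t
      fromW : Witness D (gatomᵗ xs) X → satT {G = G} 𝔄 (gatomᵗ xs) X
      fromW (I , rep , v) = lift (proj₂ definition (rels (restrict ↪-Q I) , valid))
        where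
        S≈R : restrict ↪-S I ≈ᴵ R
        S≈R j t = ⇔-sym (relT-proj dom rep (xs j) (xs⊆D j) t)
                  ⇔-∘ to (projections-valid xs I) (λ ρ → proj₂ (v ρ)) j t
        valid : ∀ ρ → satF (pairStruct tG (U 𝔄) (elem 𝔄) R (restrict ↪-Q I)) (body φQ) ρ
        valid ρ = to (pairStruct-cong tG (elem 𝔄) {restrict ↪-S I} {R} {restrict ↪-Q I} {restrict ↪-Q I}
                        S≈R (λ _ _ → ⇔-id _) (body φQ) ρ)
                     (to (rename-pair-sem ↪-S ↪-Q 𝔄 I (body φQ) ρ) (proj₁ (v ρ)))

    correct : (D : Subset k) (φ : FOQ τ k G) → WS-FOQ D φ → Correct D φ
    correct D (relᵗ R xs)  xs⊆D X dom =
      literal-case dom _ (relᶠ (inj₁ R) xs) λ _ → relation-meaning (rel 𝔄 R) xs xs⊆D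
    correct D (nrelᵗ R xs) xs⊆D X dom =
      literal-case dom _ (negᶠ (relᶠ (inj₁ R) xs)) λ _ → relation-meaning (λ t → ¬ rel 𝔄 R t) xs xs⊆D
    correct D (eqᵗ x y)  (x∈D , y∈D) X dom =
      literal-case dom _ (eqᶠ x y) λ _ → equality-meaning x∈D y∈D
    correct D (neqᵗ x y) (x∈D , y∈D) X dom =
      literal-case dom _ (negᶠ (eqᶠ x y)) λ _ → inequality-meaning x∈D y∈D
    correct D (andᵗ φ ψ) (wsφ , wsψ) = and-case φ ψ (correct D φ wsφ) (correct D ψ wsψ)
    correct D (orᵗ φ ψ)  (wsφ , wsψ) = or-case φ ψ (correct D φ wsφ) (correct D ψ wsψ)
    correct D (exᵗ x φ)  ws = ex-case x φ (correct (D [ x ]≔ inside) φ ws)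
    correct D (faᵗ x φ)  ws = fa-case x φ (correct (D [ x ]≔ inside) φ ws)
    correct D (gatomᵗ xs) ws = gatom-case xs ws

    sentence-correct : (φ : FOQ τ k G) → WS-FOQ ⊥ φ → (𝔄 ⊨Q φ) ⇔ (𝔄 ⊨ESO sentence φ)
    sentence-correct φ ws = mk⇔ toESO fromESO ⇔-∘ correct ⊥ φ ws X₀ dom₀
      where
      X₀ : Team (U 𝔄) k
      X₀ s = s ≡ replicate k nothing
      ρ₀ : Vec (U 𝔄) k
      ρ₀ = replicate k (elem 𝔄)
      dom₀ : HasDomain X₀ ⊥
      dom₀ = ↾-domain λ s s≡∅ → ρ₀ , trans s≡∅ (sym (↾-⊥ ρ₀))
      toESO : Witness ⊥ φ X₀ → 𝔄 ⊨ESO sentence φ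
      toESO (I , rep , v) = rels I , λ ρ → from (closure-sem _ ρ) λ ρ′ →
        from (𝕋₀-def I ρ′) (from (rep ρ′) (↾-⊥ ρ′)) , v ρ′
        where open FOCSemantics em (expandᴵ 𝔄 I)
      fromESO : 𝔄 ⊨ESO sentence φ → Witness ⊥ φ X₀
      fromESO (I , v) = interp I , rep , λ ρ → proj₂ (valid ρ)
        where
        open FOCSemantics em (expand 𝔄 I)
        valid : Valid (andᶠ 𝕋₀ (tr ⊥ φ))
        valid = to (closure-sem _ ρ₀) (v ρ₀)
        rep : Represents ⊥ X₀ (I zero)
        rep a = mk⇔ (λ _ → ↾-⊥ a) (λ _ → to (𝕋₀-def (interp I) a) (proj₁ (valid a)))

theorem6 : ExcludedMiddle 0ℓ → ExcludedMiddle (Level.suc 0ℓ) →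
    (k : ℕ) → 1 ≤ k → (τ : Vocab) → (G : GQ) → Definable k G →
    (φ : FOQ τ k G) → WS-FOQ ⊥ φ →
    Σ (ESO τ k) λ ψ → (𝔄 : Struct τ) → ((𝔄 ⊨Q φ → 𝔄 ⊨ESO ψ) × (𝔄 ⊨ESO ψ → 𝔄 ⊨Q φ))
theorem6 em _ (suc k) (s≤s _) τ G Def φ ws =
  sentence φ , λ 𝔄 → to (sentence-correct em 𝔄 φ ws) , from (sentence-correct em 𝔄 φ ws)
  where
  -- the variable x₁ supplies the true formula x₁ = x₁
  open Translation {k = suc k} zero {τ} {G} Def
  open Correctness using (sentence-correct)
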